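{- Let $p$ be a prime number and let $F(x)\in\mathbb{F}_p[[x]]$ satisfy $$A(x)+B(x)F(x)+C(x)F(x)^2=0,$$ where $A,B,C\in\mathbb{F}_p[x]$ satisfy one of the following conditions: (i) $B(0)=1$, $C(0)=0$, $C(x)\neq0$; (ii) $B(0)=1$, $C(x)=0$; (iii) $B(0)=1$, $C(0)\neq0$, $A(0)=0$; (iv) $p\neq2$, $B(x)=0$, $C(0)=1$, and $A(x)=-(a_kx^k)^2+O(x^{2k+1})$ for some $k\in\mathbb{N}$ and some $a_k\neq0$. Then the super $1$-fraction expansion of $F(x)$ exists and is ultimately periodic.
   Context: A super $1$-fraction is a continued fraction $$\cfrac{v_0x^{k_0}}{1+u_1(x)x-\cfrac{v_1x^{k_0+k_1+1}}{1+u_2(x)x-\cfrac{v_2x^{k_1+k_2+1}}{1+u_3(x)x-\cdots}}}$$ with nonzero constants $v_j\in\mathbb{F}_p$, nonnegative integers $k_j$, and polynomials $u_j(x)$ of degree at most $k_{j-1}-1$ (the zero polynomial has degree $-1$); the expansion may terminate after finitely many levels (the zero series has the empty expansion). It is ultimately periodic if the sequence $(v_j,k_j,u_{j+1}(x))_{j\ge0}$ is ultimately periodic; a terminating expansion is regarded as ultimately periodic. -}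

module Defs where

open import Data.Nat using (ℕ; zero; suc; _≤_; _<_) renaming (_+_ to _+ℕ_; _*_ to _*ℕ_)
open import Data.Integer using (ℤ; +_; _+_; _*_; -_; _-_; 0ℤ; 1ℤ)
open import Data.Integer.Divisibility using (_∣_)
open import Data.Product using (Σ; ∃; _×_; _,_)
open import Data.Sum using (_⊎_)
open import Relation.Nullary using (¬_)
open import Relation.Binary.PropositionalEquality using (_≡_)

-- Elements of 𝔽_p are represented by integers; equality in 𝔽_p is congruence mod p.
_≡[_]_ : ℤ → ℕ → ℤ → Set
a ≡[ p ] b = (+ p) ∣ (a - b)

-- Formal power series over 𝔽_p: coefficient sequences (x^n ↦ coefficient).
PS : Set
PS = ℕ → ℤ

_≈[_]_ : PS → ℕ → PS → Set
f ≈[ p ] g = ∀ n → f n ≡[ p ] g n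

const : ℤ → PS
const a zero    = a
const a (suc n) = 0ℤ

zeroPS : PS
zeroPS _ = 0ℤ

onePS : PS
onePS = const 1ℤ

_⊕_ : PS → PS → PS
(f ⊕ g) n = f n + g n

⊖_ : PS → PS
(⊖ f) n = - f n

_⊝_ : PS → PS → PS
f ⊝ g = f ⊕ (⊖ g)

sumBelow : ℕ → (ℕ → ℤ) → ℤ
sumBelow zero    h = 0ℤ
sumBelow (suc n) h = sumBelow n h + h n

_⊛_ : PS → PS → PS
(f ⊛ g) n = sumBelow (suc n) (λ i → f i * g (n Data.Nat.∸ i))

shift : ℕ → PS → PS
shift zero    f n       = f n
shift (suc k) f zero    = 0ℤ
shift (suc k) f (suc n) = shift k f n

mono : ℤ → ℕ → PS
mono a k = shift k (const a)

IsPoly : ℕ → PS → Set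
IsPoly p f = ∃ λ d → ∀ n → d ≤ n → f n ≡[ p ] 0ℤ

DegBelow : ℕ → ℕ → PS → Set
DegBelow p k f = ∀ i → k ≤ i → f i ≡[ p ] 0ℤ

-- The value of the (possibly infinite) continued fraction is described by
-- its tails G j, G 0 = F, where
--   G j = v j x^{k j} / (1 + u (j+1)(x) x - x^{k j + 1} G (j+1)),
-- so that  F = v₀x^{k₀}/(1+u₁x - v₁x^{k₀+k₁+1}/(1+u₂x - ...)).

record Level (p : ℕ) (v : ℕ → ℤ) (k : ℕ → ℕ) (u : ℕ → PS) (G : ℕ → PS) (j : ℕ) : Set where
  field
    v-nonzero : ¬ (v j ≡[ p ] 0ℤ)
    u-deg     : DegBelow p (k j) (u (suc j))
    equation  : (G j ⊛ ((onePS ⊕ shift 1 (u (suc j))) ⊝ shift (suc (k j)) (G (suc j))))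
                  ≈[ p ] mono (v j) (k j)

-- expansion terminating after N levels (N = 0: the zero series, empty expansion)
FiniteExpansion : ℕ → PS → Set
FiniteExpansion p F =
  Σ ℕ λ N → Σ (ℕ → ℤ) λ v → Σ (ℕ → ℕ) λ k → Σ (ℕ → PS) λ u → Σ (ℕ → PS) λ G →
    (G 0 ≈[ p ] F) × (∀ j → j < N → Level p v k u G j) × (G N ≈[ p ] zeroPS)

UltPeriodic : ℕ → (ℕ → ℤ) → (ℕ → ℕ) → (ℕ → PS) → Set
UltPeriodic p v k u =
  Σ ℕ λ n₀ → Σ ℕ λ T → (1 ≤ T) × (∀ j → n₀ ≤ j →
    (v (j +ℕ T) ≡[ p ] v j) × (k (j +ℕ T) ≡ k j) ×
    (∀ i → u (suc (j +ℕ T)) i ≡[ p ] u (suc j) i))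

PeriodicInfiniteExpansion : ℕ → PS → Set
PeriodicInfiniteExpansion p F =
  Σ (ℕ → ℤ) λ v → Σ (ℕ → ℕ) λ k → Σ (ℕ → PS) λ u → Σ (ℕ → PS) λ G →
    (G 0 ≈[ p ] F) × (∀ j → Level p v k u G j) × UltPeriodic p v k u

-- "the super 1-fraction expansion of F exists and is ultimately periodic"
-- (terminating expansions count as ultimately periodic)
HasUltPeriodicSuper1Fraction : ℕ → PS → Set
HasUltPeriodicSuper1Fraction p F = FiniteExpansion p F ⊎ PeriodicInfiniteExpansion p F

Conditions : ℕ → PS → PS → PS → Set
Conditions p A B C =
    ((B 0 ≡[ p ] 1ℤ) × (C 0 ≡[ p ] 0ℤ) × ¬ (C ≈[ p ] zeroPS))
  ⊎ ((B 0 ≡[ p ] 1ℤ) × (C ≈[ p ] zeroPS))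
  ⊎ ((B 0 ≡[ p ] 1ℤ) × ¬ (C 0 ≡[ p ] 0ℤ) × (A 0 ≡[ p ] 0ℤ))
  ⊎ (¬ (p ≡ 2) × (B ≈[ p ] zeroPS) × (C 0 ≡[ p ] 1ℤ) ×
      (∃ λ k → ∃ λ a → ¬ (a ≡[ p ] 0ℤ) ×
        (∀ n → n ≤ 2 *ℕ k → A n ≡[ p ] (⊖ (mono a k ⊛ mono a k)) n)))

-- A root G of A + B G + C G² = 0 with B(0) ≠ 0 and C(0) = 0 is unique.  If
-- A ≠ 0 has order k, then so does G, and writing G = v x^k / (1 + u x − x^{k+1} G′)
-- and clearing denominators shows that the tail G′ is again such a root, of an
-- equation A′ + B′ G′ + C′ G′² = 0 obeying the same degree bounds as A, B, C.
-- Over 𝔽_p there are only finitely many such equations, so two levels of the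
-- expansion lead to the same equation, hence to the same tail; as each level is
-- determined by the series it expands, the expansion is periodic from there on,
-- unless it stops earlier with A = 0.  Conditions (i)–(iv) are what is needed
-- for the first level to produce an equation of this kind.

module Submission where

open import Algebra.Bundles using (CommutativeRing)
import Algebra.Solver.Ring
import Algebra.Solver.Ring.AlmostCommutativeRing as ACR
open import Data.Bool using (if_then_else_)
open import Data.Empty using (⊥-elim)
open import Data.Fin as Fin using (Fin; toℕ; fromℕ<; combine)
import Data.Fin.Properties as Finₚ
open import Data.Integer as ℤ using (ℤ; +_; -[1+_]; _+_; _*_; -_; _-_; 0ℤ; 1ℤ; ∣_∣)
open import Data.Integer.DivMod using (_%ℕ_; _/ℕ_; n%ℕd<d; a≡a%ℕn+[a/ℕn]*n)
import Data.Integer.Divisibility.Signed as ℤ∣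
import Data.Integer.Properties as ℤₚ
open import Data.Integer.Tactic.RingSolver using (solve-∀)
open import Data.Maybe using (Maybe; just; nothing)
open import Data.Nat as ℕ using (ℕ; zero; suc; _≤_; _<_; z≤n; s≤s; _≤?_; _<?_; _^_; _⊔_; _∸_)
open import Data.Nat.Coprimality using (Coprime; coprime-Bézout)
import Data.Nat.Divisibility as ℕ∣
open import Data.Nat.GCD using (module Bézout)
open import Data.Nat.Induction using (<-rec)
open import Data.Nat.Primality using (Prime; euclidsLemma; prime⇒irreducible; prime⇒nonZero; ¬prime[1]; prime[2])
import Data.Nat.Properties as ℕₚ
import Data.Nat.Tactic.RingSolver as ℕ-solver
open import Data.Product using (Σ; _×_; _,_; proj₁; proj₂)
open import Data.Sum using (_⊎_; inj₁; inj₂; swap; [_,_]′) renaming (map to map-⊎; map₂ to map₂-⊎)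
open import Function using (_∘_)
open import Level as Universe using (0ℓ)
open import Relation.Binary.Bundles using (Setoid)
open import Relation.Binary.Definitions using (Tri; tri<; tri≈; tri>)
open import Relation.Binary.PropositionalEquality
  using (_≡_; refl; sym; trans; cong; cong₂; subst; subst₂; module ≡-Reasoning)
import Relation.Binary.Reasoning.Setoid as SetoidReasoning
open import Relation.Binary.Structures using (IsEquivalence)
open import Relation.Nullary using (¬_; Dec; yes; no; does)
open import Relation.Nullary.Decidable using (dec-true; dec-false)

open import Defs

module Congruence (p : ℕ) where

  -- A record rather than Defs._≡[_]_, so that both sides are recoverable
  -- from the type during unification.
  infix 4 _≋_
  record _≋_ (a b : ℤ) : Set where
    constructor mk≋
    field divides-difference : + p ℤ∣.∣ (a - b)
  open _≋_ public

  ≋⇒≡[] : ∀ {a b} → a ≋ b → a ≡[ p ] b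
  ≋⇒≡[] {a} {b} (mk≋ d) = ℤ∣.∣⇒∣ᵤ {+ p} {a - b} d

  ≡[]⇒≋ : ∀ {a b} → a ≡[ p ] b → a ≋ b
  ≡[]⇒≋ {a} {b} d = mk≋ (ℤ∣.∣ᵤ⇒∣ {+ p} {a - b} d)

  divides-≡ : ∀ {x y} → x ≡ y → + p ℤ∣.∣ x → + p ℤ∣.∣ y
  divides-≡ = subst (+ p ℤ∣.∣_)

  ≡⇒≋ : ∀ {a b} → a ≡ b → a ≋ b
  ≡⇒≋ {a} refl = mk≋ (ℤ∣.divides 0ℤ (trans (ℤₚ.+-inverseʳ a) (sym (ℤₚ.*-zeroˡ (+ p)))))

  ≋-refl : ∀ {a} → a ≋ a
  ≋-refl = ≡⇒≋ refl

  ≋-sym : ∀ {a b} → a ≋ b → b ≋ a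
  ≋-sym {a} {b} (mk≋ d) = mk≋ (divides-≡ (lemma a b) (ℤ∣.∣m⇒∣-m d))
    where lemma : ∀ a b → - (a - b) ≡ b - a
          lemma = solve-∀

  ≋-trans : ∀ {a b c} → a ≋ b → b ≋ c → a ≋ c
  ≋-trans {a} {b} {c} (mk≋ d) (mk≋ e) = mk≋ (divides-≡ (lemma a b c) (ℤ∣.∣m∣n⇒∣m+n d e))
    where lemma : ∀ a b c → (a - b) + (b - c) ≡ a - c
          lemma = solve-∀

  +-cong : ∀ {a b c d} → a ≋ b → c ≋ d → a + c ≋ b + d
  +-cong {a} {b} {c} {d} (mk≋ e) (mk≋ f) = mk≋ (divides-≡ (lemma a b c d) (ℤ∣.∣m∣n⇒∣m+n e f))
    where lemma : ∀ a b c d → (a - b) + (c - d) ≡ (a + c) - (b + d)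
          lemma = solve-∀

  -‿cong : ∀ {a b} → a ≋ b → - a ≋ - b
  -‿cong {a} {b} (mk≋ e) = mk≋ (divides-≡ (lemma a b) (ℤ∣.∣m⇒∣-m e))
    where lemma : ∀ a b → - (a - b) ≡ (- a) - (- b)
          lemma = solve-∀

  *-cong : ∀ {a b c d} → a ≋ b → c ≋ d → a * c ≋ b * d
  *-cong {a} {b} {c} {d} (mk≋ e) (mk≋ f) =
    mk≋ (divides-≡ (lemma a b c d) (ℤ∣.∣m∣n⇒∣m+n (ℤ∣.∣n⇒∣m*n a f) (ℤ∣.∣m⇒∣m*n d e)))
    where lemma : ∀ a b c d → a * (c - d) + (a - b) * d ≡ a * c - b * d
          lemma = solve-∀

  ≋0⇒∣ : ∀ {a} → a ≋ 0ℤ → + p ℤ∣.∣ a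
  ≋0⇒∣ {a} (mk≋ d) = divides-≡ (ℤₚ.+-identityʳ a) d

  ∣⇒≋0 : ∀ {a} → + p ℤ∣.∣ a → a ≋ 0ℤ
  ∣⇒≋0 {a} d = mk≋ (divides-≡ (sym (ℤₚ.+-identityʳ a)) d)

  a≋b⇒a-b≋0 : ∀ {a b} → a ≋ b → a - b ≋ 0ℤ
  a≋b⇒a-b≋0 (mk≋ d) = ∣⇒≋0 d

  a-b≋0⇒a≋b : ∀ {a b} → a - b ≋ 0ℤ → a ≋ b
  a-b≋0⇒a≋b e = mk≋ (≋0⇒∣ e)

  ≋-setoid : Setoid 0ℓ 0ℓ
  ≋-setoid = record
    { Carrier = ℤ ; _≈_ = _≋_
    ; isEquivalence = record { refl = ≋-refl ; sym = ≋-sym ; trans = ≋-trans } }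

  module ≋-Reasoning = SetoidReasoning ≋-setoid

  _≋?_ : ∀ a b → Dec (a ≋ b)
  a ≋? b with + p ℤ∣.∣? (a - b)
  ... | yes d = yes (mk≋ d)
  ... | no ¬d = no (λ { (mk≋ d) → ¬d d })

  -≋0⇒≋0 : ∀ {a} → - a ≋ 0ℤ → a ≋ 0ℤ
  -≋0⇒≋0 {a} e = ≋-trans (≡⇒≋ (sym (ℤₚ.neg-involutive a))) (-‿cong e)

  ≋0⇒-≋0 : ∀ {a} → a ≋ 0ℤ → - a ≋ 0ℤ
  ≋0⇒-≋0 e = -‿cong e

  module PrimeField (p-prime : Prime p) where

    ∣ᵤ⇒≋0 : ∀ a → p ℕ∣.∣ ∣ a ∣ → a ≋ 0ℤ
    ∣ᵤ⇒≋0 a d = ∣⇒≋0 (ℤ∣.∣ᵤ⇒∣ {+ p} {a} d)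

    ≋0⇒∣ᵤ : ∀ {a} → a ≋ 0ℤ → p ℕ∣.∣ ∣ a ∣
    ≋0⇒∣ᵤ {a} e = ℤ∣.∣⇒∣ᵤ {+ p} {a} (≋0⇒∣ e)

    x*y≋0⇒x≋0⊎y≋0 : ∀ {a b} → a * b ≋ 0ℤ → a ≋ 0ℤ ⊎ b ≋ 0ℤ
    x*y≋0⇒x≋0⊎y≋0 {a} {b} e
      with euclidsLemma ∣ a ∣ ∣ b ∣ p-prime (subst (p ℕ∣.∣_) (ℤₚ.abs-* a b) (≋0⇒∣ᵤ e))
    ... | inj₁ d = inj₁ (∣ᵤ⇒≋0 a d)
    ... | inj₂ d = inj₂ (∣ᵤ⇒≋0 b d)

    x≉0∧y≉0⇒x*y≉0 : ∀ {a b} → ¬ a ≋ 0ℤ → ¬ b ≋ 0ℤ → ¬ a * b ≋ 0ℤ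
    x≉0∧y≉0⇒x*y≉0 a≉0 b≉0 e with x*y≋0⇒x≋0⊎y≋0 e
    ... | inj₁ a≋0 = a≉0 a≋0
    ... | inj₂ b≋0 = b≉0 b≋0

    *-cancelˡ-≋ : ∀ {a b c} → ¬ a ≋ 0ℤ → a * b ≋ a * c → b ≋ c
    *-cancelˡ-≋ {a} {b} {c} a≉0 ab≋ac
      with x*y≋0⇒x≋0⊎y≋0 (≋-trans (≡⇒≋ (lemma a b c)) (a≋b⇒a-b≋0 ab≋ac))
      where lemma : ∀ a b c → a * (b - c) ≡ a * b - a * c
            lemma = solve-∀
    ... | inj₁ a≋0   = ⊥-elim (a≉0 a≋0)
    ... | inj₂ b-c≋0 = a-b≋0⇒a≋b b-c≋0

    x*x≋0⇒x≋0 : ∀ {a} → a * a ≋ 0ℤ → a ≋ 0ℤ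
    x*x≋0⇒x≋0 {a} e with x*y≋0⇒x≋0⊎y≋0 {a} {a} e
    ... | inj₁ a≋0 = a≋0
    ... | inj₂ a≋0 = a≋0

    1≉0 : ¬ 1ℤ ≋ 0ℤ
    1≉0 e = ¬prime[1] (subst Prime (ℕ∣.∣1⇒≡1 (≋0⇒∣ᵤ e)) p-prime)

    2≉0 : ¬ p ≡ 2 → ¬ + 2 ≋ 0ℤ
    2≉0 p≢2 e with prime⇒irreducible prime[2] (≋0⇒∣ᵤ e)
    ... | inj₁ p≡1 = ¬prime[1] (subst Prime p≡1 p-prime)
    ... | inj₂ p≡2 = p≢2 p≡2

    private
      coprime : ∀ n → ¬ p ℕ∣.∣ n → Coprime p n
      coprime n p∤n (d∣p , d∣n) with prime⇒irreducible p-prime d∣p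
      ... | inj₁ d≡1 = d≡1
      ... | inj₂ refl = ⊥-elim (p∤n d∣n)

      ℕ-inverse : ∀ n → ¬ p ℕ∣.∣ n → Σ ℤ λ w → + n * w ≋ 1ℤ
      ℕ-inverse n p∤n with coprime-Bézout (coprime n p∤n)
      ... | Bézout.-+ x y eq = + y , ≋-sym (mk≋ (ℤ∣.divides (- + x) (begin
            1ℤ - + n * + y          ≡⟨ cong (λ z → 1ℤ - z) (trans (ℤₚ.*-comm (+ n) (+ y)) (sym (ℤₚ.pos-* y n))) ⟩
            1ℤ - + (y ℕ.* n)        ≡⟨ cong (λ z → 1ℤ - + z) (sym eq) ⟩
            1ℤ - + (1 ℕ.+ x ℕ.* p)  ≡⟨ cong (λ z → 1ℤ - z)
                                         (trans (ℤₚ.pos-+ 1 (x ℕ.* p)) (cong (λ z → 1ℤ + z) (ℤₚ.pos-* x p))) ⟩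
            1ℤ - (1ℤ + + x * + p)   ≡⟨ lemma (+ x) (+ p) ⟩
            - + x * + p             ∎)))
        where open ≡-Reasoning
              lemma : ∀ a b → 1ℤ - (1ℤ + a * b) ≡ - a * b
              lemma = solve-∀
      ... | Bézout.+- x y eq = - + y , ≋-sym (mk≋ (ℤ∣.divides (+ x) (begin
            1ℤ - + n * - + y        ≡⟨ lemma (+ n) (+ y) ⟩
            + 1 + + y * + n         ≡⟨ cong (λ z → 1ℤ + z) (sym (ℤₚ.pos-* y n)) ⟩
            + (1 ℕ.+ y ℕ.* n)       ≡⟨ cong +_ eq ⟩
            + (x ℕ.* p)             ≡⟨ ℤₚ.pos-* x p ⟩
            + x * + p               ∎)))
        where open ≡-Reasoning
              lemma : ∀ a b → 1ℤ - a * - b ≡ 1ℤ + b * a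
              lemma = solve-∀

    ≉0⇒invertible : ∀ a → ¬ a ≋ 0ℤ → Σ ℤ λ w → a * w ≋ 1ℤ
    ≉0⇒invertible (+ n) a≉0 = ℕ-inverse n (λ d → a≉0 (∣ᵤ⇒≋0 (+ n) d))
    ≉0⇒invertible -[1+ q ] a≉0 with ℕ-inverse (suc q) (λ d → a≉0 (∣ᵤ⇒≋0 -[1+ q ] d))
    ... | w , e = - w , ≋-trans (≡⇒≋ (lemma (+ suc q) w)) e
      where lemma : ∀ a b → (- a) * (- b) ≡ a * b
            lemma = solve-∀

sumBelow-cong : ∀ n {f g : ℕ → ℤ} → (∀ i → i < n → f i ≡ g i) → sumBelow n f ≡ sumBelow n g
sumBelow-cong zero     h = refl
sumBelow-cong (suc n) h = cong₂ _+_ (sumBelow-cong n (λ i i<n → h i (ℕₚ.m<n⇒m<1+n i<n))) (h n ℕₚ.≤-refl)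

sumBelow-+ : ∀ n (f g : ℕ → ℤ) → sumBelow n (λ i → f i + g i) ≡ sumBelow n f + sumBelow n g
sumBelow-+ zero     f g = refl
sumBelow-+ (suc n) f g rewrite sumBelow-+ n f g = lemma (sumBelow n f) (sumBelow n g) (f n) (g n)
  where lemma : ∀ a b c d → a + b + (c + d) ≡ a + c + (b + d)
        lemma = solve-∀

sumBelow-*ˡ : ∀ n c (f : ℕ → ℤ) → sumBelow n (λ i → c * f i) ≡ c * sumBelow n f
sumBelow-*ˡ zero     c f = sym (ℤₚ.*-zeroʳ c)
sumBelow-*ˡ (suc n) c f rewrite sumBelow-*ˡ n c f = sym (ℤₚ.*-distribˡ-+ c (sumBelow n f) (f n))

sumBelow-*ʳ : ∀ n c (f : ℕ → ℤ) → sumBelow n (λ i → f i * c) ≡ sumBelow n f * c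
sumBelow-*ʳ zero     c f = sym (ℤₚ.*-zeroˡ c)
sumBelow-*ʳ (suc n) c f rewrite sumBelow-*ʳ n c f = sym (ℤₚ.*-distribʳ-+ c (sumBelow n f) (f n))

sumBelow-zero : ∀ n → sumBelow n (λ _ → 0ℤ) ≡ 0ℤ
sumBelow-zero zero     = refl
sumBelow-zero (suc n) rewrite sumBelow-zero n = refl

sumBelow-suc-head : ∀ n (f : ℕ → ℤ) → sumBelow (suc n) f ≡ f 0 + sumBelow n (λ i → f (suc i))
sumBelow-suc-head zero     f = ℤₚ.+-comm 0ℤ (f 0)
sumBelow-suc-head (suc n) f rewrite sumBelow-suc-head n f = ℤₚ.+-assoc (f 0) _ _

sumBelow-reverse : ∀ n (f : ℕ → ℤ) → sumBelow n f ≡ sumBelow n (λ i → f (n ∸ suc i))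
sumBelow-reverse zero     f = refl
sumBelow-reverse (suc n) f = begin
  sumBelow n f + f n                          ≡⟨ cong (_+ f n) (sumBelow-reverse n f) ⟩
  sumBelow n (λ i → f (n ∸ suc i)) + f n      ≡⟨ ℤₚ.+-comm _ (f n) ⟩
  f n + sumBelow n (λ i → f (n ∸ suc i))      ≡⟨ sym (sumBelow-suc-head n (λ i → f (suc n ∸ suc i))) ⟩
  sumBelow (suc n) (λ i → f (suc n ∸ suc i))  ∎
  where open ≡-Reasoning

sumBelow-triangle : ∀ n (a : ℕ → ℕ → ℤ) →
  sumBelow n (λ i → sumBelow (suc i) (λ j → a j i)) ≡
  sumBelow n (λ j → sumBelow (n ∸ j) (λ t → a j (j ℕ.+ t)))
sumBelow-triangle zero     a = refl
sumBelow-triangle (suc n) a = begin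
  sumBelow n (λ i → sumBelow (suc i) (λ j → a j i)) + column
    ≡⟨ cong (_+ column) (sumBelow-triangle n a) ⟩
  rows n + column
    ≡⟨ cong (_+ column) (sym (trans (cong (λ m → rows n + sumBelow m (λ t → a n (n ℕ.+ t))) (ℕₚ.n∸n≡0 n))
                                    (ℤₚ.+-identityʳ (rows n)))) ⟩
  (rows n + sumBelow (n ∸ n) (λ t → a n (n ℕ.+ t))) + column
    ≡⟨ sym (sumBelow-+ (suc n) (λ j → sumBelow (n ∸ j) (λ t → a j (j ℕ.+ t))) (λ j → a j n)) ⟩
  sumBelow (suc n) (λ j → sumBelow (n ∸ j) (λ t → a j (j ℕ.+ t)) + a j n)
    ≡⟨ sumBelow-cong (suc n) extend-row ⟩
  rows (suc n) ∎
  where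
  open ≡-Reasoning
  column : ℤ
  column = sumBelow (suc n) (λ j → a j n)
  rows : ℕ → ℤ
  rows m = sumBelow m (λ j → sumBelow (m ∸ j) (λ t → a j (j ℕ.+ t)))
  extend-row : ∀ j → j < suc n →
    sumBelow (n ∸ j) (λ t → a j (j ℕ.+ t)) + a j n ≡ sumBelow (suc n ∸ j) (λ t → a j (j ℕ.+ t))
  extend-row j (s≤s j≤n) rewrite ℕₚ.+-∸-assoc 1 j≤n | ℕₚ.m+[n∸m]≡n j≤n = refl

⊛-comm : ∀ f g n → (f ⊛ g) n ≡ (g ⊛ f) n
⊛-comm f g n = begin
  sumBelow (suc n) (λ i → f i * g (n ∸ i))
    ≡⟨ sumBelow-reverse (suc n) (λ i → f i * g (n ∸ i)) ⟩
  sumBelow (suc n) (λ i → f (n ∸ i) * g (n ∸ (n ∸ i)))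
    ≡⟨ sumBelow-cong (suc n) (λ i i≤n → trans (cong (λ z → f (n ∸ i) * g z) (ℕₚ.m∸[m∸n]≡n (ℕₚ.≤-pred i≤n)))
                                              (ℤₚ.*-comm (f (n ∸ i)) (g i))) ⟩
  sumBelow (suc n) (λ i → g i * f (n ∸ i)) ∎
  where open ≡-Reasoning

⊛-assoc : ∀ f g h n → ((f ⊛ g) ⊛ h) n ≡ (f ⊛ (g ⊛ h)) n
⊛-assoc f g h n = begin
  sumBelow (suc n) (λ i → sumBelow (suc i) (λ j → f j * g (i ∸ j)) * h (n ∸ i))
    ≡⟨ sumBelow-cong (suc n) (λ i _ → sym (sumBelow-*ʳ (suc i) (h (n ∸ i)) (λ j → f j * g (i ∸ j)))) ⟩
  sumBelow (suc n) (λ i → sumBelow (suc i) (λ j → f j * g (i ∸ j) * h (n ∸ i)))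
    ≡⟨ sumBelow-triangle (suc n) (λ j i → f j * g (i ∸ j) * h (n ∸ i)) ⟩
  sumBelow (suc n) (λ j → sumBelow (suc n ∸ j) (λ t → f j * g ((j ℕ.+ t) ∸ j) * h (n ∸ (j ℕ.+ t))))
    ≡⟨ sumBelow-cong (suc n) inner ⟩
  sumBelow (suc n) (λ j → f j * sumBelow (suc (n ∸ j)) (λ t → g t * h ((n ∸ j) ∸ t))) ∎
  where
  open ≡-Reasoning
  inner : ∀ j → j < suc n →
    sumBelow (suc n ∸ j) (λ t → f j * g ((j ℕ.+ t) ∸ j) * h (n ∸ (j ℕ.+ t)))
      ≡ f j * sumBelow (suc (n ∸ j)) (λ t → g t * h ((n ∸ j) ∸ t))
  inner j (s≤s j≤n) rewrite ℕₚ.+-∸-assoc 1 j≤n = trans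
    (sumBelow-cong (suc (n ∸ j)) (λ t _ → trans
       (cong₂ (λ a b → f j * g a * h b) (ℕₚ.m+n∸m≡n j t) (sym (ℕₚ.∸-+-assoc n j t)))
       (ℤₚ.*-assoc (f j) (g t) (h ((n ∸ j) ∸ t)))))
    (sumBelow-*ˡ (suc (n ∸ j)) (f j) (λ t → g t * h ((n ∸ j) ∸ t)))

⊛-distribˡ-⊕ : ∀ f g h n → (f ⊛ (g ⊕ h)) n ≡ ((f ⊛ g) ⊕ (f ⊛ h)) n
⊛-distribˡ-⊕ f g h n = trans
  (sumBelow-cong (suc n) (λ i _ → ℤₚ.*-distribˡ-+ (f i) (g (n ∸ i)) (h (n ∸ i))))
  (sumBelow-+ (suc n) (λ i → f i * g (n ∸ i)) (λ i → f i * h (n ∸ i)))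

⊛-identityˡ : ∀ f n → (onePS ⊛ f) n ≡ f n
⊛-identityˡ f n = begin
  sumBelow (suc n) (λ i → const 1ℤ i * f (n ∸ i))
    ≡⟨ sumBelow-suc-head n (λ i → const 1ℤ i * f (n ∸ i)) ⟩
  1ℤ * f n + sumBelow n (λ i → 0ℤ * f (n ∸ suc i))
    ≡⟨ cong₂ _+_ (ℤₚ.*-identityˡ (f n))
                 (trans (sumBelow-cong n (λ i _ → ℤₚ.*-zeroˡ (f (n ∸ suc i)))) (sumBelow-zero n)) ⟩
  f n + 0ℤ
    ≡⟨ ℤₚ.+-identityʳ (f n) ⟩
  f n ∎
  where open ≡-Reasoning

⊛-zeroʳ : ∀ f n → (f ⊛ zeroPS) n ≡ 0ℤ
⊛-zeroʳ f n = trans (sumBelow-cong (suc n) (λ i _ → ℤₚ.*-zeroʳ (f i))) (sumBelow-zero (suc n))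

⊛-at-0 : ∀ f g → (f ⊛ g) 0 ≡ f 0 * g 0
⊛-at-0 f g = ℤₚ.+-identityˡ (f 0 * g 0)

shift-+ : ∀ e f n → shift e f (e ℕ.+ n) ≡ f n
shift-+ zero     f n = refl
shift-+ (suc e) f n = shift-+ e f n

shift-at : ∀ e f → shift e f e ≡ f 0
shift-at e f = trans (cong (shift e f) (sym (ℕₚ.+-identityʳ e))) (shift-+ e f 0)

shift-< : ∀ e f i → i < e → shift e f i ≡ 0ℤ
shift-< (suc e) f zero     _         = refl
shift-< (suc e) f (suc i) (s≤s i<e) = shift-< e f i i<e

shift-≥ : ∀ e f i → e ≤ i → shift e f i ≡ f (i ∸ e)
shift-≥ e f i e≤i = trans (cong (shift e f) (sym (ℕₚ.m+[n∸m]≡n e≤i))) (shift-+ e f (i ∸ e))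

shift-shift : ∀ a b f n → shift a (shift b f) n ≡ shift (a ℕ.+ b) f n
shift-shift zero     b f n       = refl
shift-shift (suc a) b f zero    = refl
shift-shift (suc a) b f (suc n) = shift-shift a b f n

shift-suc : ∀ k f n → shift (suc k) f n ≡ shift 1 (shift k f) n
shift-suc k f zero    = refl
shift-suc k f (suc n) = refl

shift1-⊛ : ∀ g f n → (shift 1 g ⊛ f) n ≡ shift 1 (g ⊛ f) n
shift1-⊛ g f zero    = refl
shift1-⊛ g f (suc n) = trans (sumBelow-suc-head (suc n) (λ i → shift 1 g i * f (suc n ∸ i))) (ℤₚ.+-identityˡ _)

cons : ∀ {A : Set} → A → (ℕ → A) → ℕ → A
cons a f zero    = a
cons a f (suc n) = f n

down : ℕ → PS → PS
down e f n = f (e ℕ.+ n)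

down-at-0 : ∀ e f → down e f 0 ≡ f e
down-at-0 e f = cong f (ℕₚ.+-identityʳ e)

truncate : ℕ → PS → PS
truncate zero     f i       = 0ℤ
truncate (suc k) f zero    = f zero
truncate (suc k) f (suc i) = truncate k (λ j → f (suc j)) i

truncate-< : ∀ k f i → i < k → truncate k f i ≡ f i
truncate-< (suc k) f zero     _         = refl
truncate-< (suc k) f (suc i) (s≤s i<k) = truncate-< k (λ j → f (suc j)) i i<k

truncate-≥ : ∀ k f i → k ≤ i → truncate k f i ≡ 0ℤ
truncate-≥ zero     f i       _         = refl
truncate-≥ (suc k) f (suc i) (s≤s k≤i) = truncate-≥ k (λ j → f (suc j)) i k≤i

module PowerSeries (p : ℕ) where
  open Congruence p public

  infix 4 _≈_
  record _≈_ (f g : PS) : Set where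
    constructor mk≈
    infixl 20 _!_
    field _!_ : ∀ n → f n ≋ g n
  open _≈_ public

  ≈⇒≈[] : ∀ {f g} → f ≈ g → f ≈[ p ] g
  ≈⇒≈[] e n = ≋⇒≡[] (e ! n)

  ≈[]⇒≈ : ∀ {f g} → f ≈[ p ] g → f ≈ g
  ≈[]⇒≈ e = mk≈ λ n → ≡[]⇒≋ (e n)

  ≈-refl : ∀ {f} → f ≈ f
  ≈-refl = mk≈ λ _ → ≋-refl

  ≈-sym : ∀ {f g} → f ≈ g → g ≈ f
  ≈-sym e = mk≈ λ n → ≋-sym (e ! n)

  ≈-trans : ∀ {f g h} → f ≈ g → g ≈ h → f ≈ h
  ≈-trans e e′ = mk≈ λ n → ≋-trans (e ! n) (e′ ! n)

  ≡⇒≈ : ∀ {f g} → (∀ n → f n ≡ g n) → f ≈ g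
  ≡⇒≈ e = mk≈ λ n → ≡⇒≋ (e n)

  sumBelow-cong≋ : ∀ n {f g : ℕ → ℤ} → (∀ i → i < n → f i ≋ g i) → sumBelow n f ≋ sumBelow n g
  sumBelow-cong≋ zero     h = ≋-refl
  sumBelow-cong≋ (suc n) h = +-cong (sumBelow-cong≋ n (λ i i<n → h i (ℕₚ.m<n⇒m<1+n i<n))) (h n ℕₚ.≤-refl)

  ⊕-cong : ∀ {f f′ g g′} → f ≈ f′ → g ≈ g′ → (f ⊕ g) ≈ (f′ ⊕ g′)
  ⊕-cong e e′ = mk≈ λ n → +-cong (e ! n) (e′ ! n)

  ⊖-cong : ∀ {f f′} → f ≈ f′ → (⊖ f) ≈ (⊖ f′)
  ⊖-cong e = mk≈ λ n → -‿cong (e ! n)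

  ⊝-cong : ∀ {f f′ g g′} → f ≈ f′ → g ≈ g′ → (f ⊝ g) ≈ (f′ ⊝ g′)
  ⊝-cong e e′ = ⊕-cong e (⊖-cong e′)

  ⊛-cong : ∀ {f f′ g g′} → f ≈ f′ → g ≈ g′ → (f ⊛ g) ≈ (f′ ⊛ g′)
  ⊛-cong e e′ = mk≈ λ n → sumBelow-cong≋ (suc n) (λ i _ → *-cong (e ! i) (e′ ! (n ∸ i)))

  zeroPS≈const0 : zeroPS ≈ const 0ℤ
  zeroPS≈const0 = mk≈ λ { zero → ≋-refl ; (suc n) → ≋-refl }

  ⊝≈0⇒≈ : ∀ {f g} → (f ⊝ g) ≈ zeroPS → f ≈ g
  ⊝≈0⇒≈ e = mk≈ λ n → a-b≋0⇒a≋b (e ! n)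

  powerSeriesRing : CommutativeRing 0ℓ 0ℓ
  powerSeriesRing = record
    { Carrier = PS ; _≈_ = _≈_ ; _+_ = _⊕_ ; _*_ = _⊛_ ; -_ = ⊖_ ; 0# = zeroPS ; 1# = onePS
    ; isCommutativeRing = record
      { isRing = record
        { +-isAbelianGroup = record
          { isGroup = record
            { isMonoid = record
              { isSemigroup = record
                { isMagma = record { isEquivalence = ≈-isEquivalence ; ∙-cong = ⊕-cong }
                ; assoc = λ f g h → ≡⇒≈ (λ n → ℤₚ.+-assoc (f n) (g n) (h n)) }
              ; identity = (λ f → ≡⇒≈ (λ n → ℤₚ.+-identityˡ (f n)))
                         , (λ f → ≡⇒≈ (λ n → ℤₚ.+-identityʳ (f n))) }
            ; inverse = (λ f → ≡⇒≈ (λ n → ℤₚ.+-inverseˡ (f n)))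
                      , (λ f → ≡⇒≈ (λ n → ℤₚ.+-inverseʳ (f n)))
            ; ⁻¹-cong = ⊖-cong }
          ; comm = λ f g → ≡⇒≈ (λ n → ℤₚ.+-comm (f n) (g n)) }
        ; *-cong = ⊛-cong
        ; *-assoc = λ f g h → ≡⇒≈ (⊛-assoc f g h)
        ; *-identity = (λ f → ≡⇒≈ (⊛-identityˡ f))
                     , (λ f → ≡⇒≈ (λ n → trans (⊛-comm f onePS n) (⊛-identityˡ f n)))
        ; distrib = (λ f g h → ≡⇒≈ (⊛-distribˡ-⊕ f g h))
                  , (λ f g h → ≡⇒≈ (λ n → trans (⊛-comm (g ⊕ h) f n)
                                         (trans (⊛-distribˡ-⊕ f g h n) (cong₂ _+_ (⊛-comm f g n) (⊛-comm f h n))))) }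
      ; *-comm = λ f g → ≡⇒≈ (⊛-comm f g) } }
    where
    ≈-isEquivalence : IsEquivalence _≈_
    ≈-isEquivalence = record { refl = ≈-refl ; sym = ≈-sym ; trans = ≈-trans }

  module ≈-Reasoning = SetoidReasoning (CommutativeRing.setoid powerSeriesRing)

  private
    const-⊛ : ∀ a b n → const (a * b) n ≋ (const a ⊛ const b) n
    const-⊛ a b zero    = ≡⇒≋ (sym (ℤₚ.+-identityˡ (a * b)))
    const-⊛ a b (suc n) = ≡⇒≋ (sym (trans (sumBelow-suc-head (suc n) (λ i → const a i * const b (suc n ∸ i)))
      (cong₂ _+_ (ℤₚ.*-zeroʳ a) (trans (sumBelow-cong (suc n) (λ i _ → ℤₚ.*-zeroˡ (const b (n ∸ i))))
                                        (sumBelow-zero (suc n))))))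

    const-homomorphism : ℤ.+-*-rawRing ACR.-Raw-AlmostCommutative⟶ ACR.fromCommutativeRing powerSeriesRing
    const-homomorphism = record
      { ⟦_⟧    = const
      ; +-homo = λ a b → mk≈ λ { zero → ≋-refl ; (suc n) → ≋-refl }
      ; *-homo = λ a b → mk≈ (const-⊛ a b)
      ; -‿homo = λ a → mk≈ λ { zero → ≋-refl ; (suc n) → ≋-refl }
      ; 0-homo = mk≈ λ { zero → ≋-refl ; (suc n) → ≋-refl }
      ; 1-homo = mk≈ λ { zero → ≋-refl ; (suc n) → ≋-refl } }

    const-≟ : ∀ a b → Maybe (const a ≈ const b)
    const-≟ a b with a ℤₚ.≟ b
    ... | yes refl = just ≈-refl
    ... | no _     = nothing

  open Algebra.Solver.Ring ℤ.+-*-rawRing (ACR.fromCommutativeRing powerSeriesRing) const-homomorphism const-≟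
    using (solve; _:=_; _:+_; _:*_; :-_; _:-_; con) public

  shift-cong : ∀ e {f g} → f ≈ g → shift e f ≈ shift e g
  shift-cong zero     eq = eq
  shift-cong (suc e) eq = mk≈ λ { zero → ≋-refl ; (suc n) → shift-cong e eq ! n }

  shift-⊛ˡ : ∀ k g f → (shift k g ⊛ f) ≈ shift k (g ⊛ f)
  shift-⊛ˡ zero     g f = ≈-refl
  shift-⊛ˡ (suc k) g f =
    ≈-trans (⊛-cong (≡⇒≈ {shift (suc k) g} (shift-suc k g)) (≈-refl {f}))
    (≈-trans (≡⇒≈ {shift 1 (shift k g) ⊛ f} (shift1-⊛ (shift k g) f))
    (≈-trans (shift-cong 1 (shift-⊛ˡ k g f))
             (≡⇒≈ {shift 1 (shift k (g ⊛ f))} (λ n → sym (shift-suc k (g ⊛ f) n)))))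

  shift-⊛ʳ : ∀ k g f → (f ⊛ shift k g) ≈ shift k (f ⊛ g)
  shift-⊛ʳ k g f = ≈-trans (≡⇒≈ (⊛-comm f (shift k g)))
                    (≈-trans (shift-⊛ˡ k g f) (shift-cong k (≡⇒≈ (⊛-comm g f))))

  shift-⊛-shift : ∀ a b f g → (shift a f ⊛ shift b g) ≈ shift (a ℕ.+ b) (f ⊛ g)
  shift-⊛-shift a b f g = ≈-trans (shift-⊛ˡ a f (shift b g))
    (≈-trans (shift-cong a (shift-⊛ʳ b g f)) (≡⇒≈ (shift-shift a b (f ⊛ g))))

  shift-injective : ∀ e {f g} → shift e f ≈ shift e g → f ≈ g
  shift-injective e {f} {g} eq = mk≈ λ n →
    subst₂ _≋_ (shift-+ e f n) (shift-+ e g n) (eq ! (e ℕ.+ n))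

  down-cong : ∀ e {f g} → f ≈ g → down e f ≈ down e g
  down-cong e eq = mk≈ λ n → eq ! (e ℕ.+ n)

  down-shift : ∀ e f → down e (shift e f) ≈ f
  down-shift e f = ≡⇒≈ (shift-+ e f)

  VanishesBelow : ℕ → PS → Set
  VanishesBelow k f = ∀ i → i < k → f i ≋ 0ℤ

  vanishesBelow-suc : ∀ {n f} → VanishesBelow n f → f n ≋ 0ℤ → VanishesBelow (suc n) f
  vanishesBelow-suc {n} below fn≋0 i i<1+n with ℕₚ.m≤n⇒m<n∨m≡n (ℕₚ.≤-pred i<1+n)
  ... | inj₁ i<n  = below i i<n
  ... | inj₂ refl = fn≋0

  shift-down : ∀ e f → VanishesBelow e f → f ≈ shift e (down e f)
  shift-down e f f<e≋0 = mk≈ λ n → case n (ℕ.<-cmp n e)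
    where
    case : ∀ n → Tri (n < e) (n ≡ e) (e < n) → f n ≋ shift e (down e f) n
    case n (tri< n<e _ _) = ≋-trans (f<e≋0 n n<e) (≡⇒≋ (sym (shift-< e (down e f) n n<e)))
    case n (tri≈ _ refl _) = ≡⇒≋ (sym (trans (shift-at e (down e f)) (down-at-0 e f)))
    case n (tri> _ _ e<n) = ≡⇒≋ (sym (trans (shift-≥ e (down e f) n (ℕₚ.<⇒≤ e<n))
                                            (cong f (ℕₚ.m+[n∸m]≡n (ℕₚ.<⇒≤ e<n)))))

  X^ : ℕ → PS
  X^ n = shift n onePS

  shift≈X^⊛ : ∀ n f → shift n f ≈ (X^ n ⊛ f)
  shift≈X^⊛ n f = ≈-sym (≈-trans (shift-⊛ˡ n onePS f) (shift-cong n (≡⇒≈ {onePS ⊛ f} (⊛-identityˡ f))))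

  X^-+ : ∀ a b → X^ (a ℕ.+ b) ≈ (X^ a ⊛ X^ b)
  X^-+ a b = ≈-sym (≈-trans (shift-⊛-shift a b onePS onePS)
                            (shift-cong (a ℕ.+ b) (≡⇒≈ {onePS ⊛ onePS} (⊛-identityˡ onePS))))

  DegreeAtMost : ℕ → PS → Set
  DegreeAtMost d f = ∀ n → d < n → f n ≋ 0ℤ

  degree-weaken : ∀ {d d′ f} → d ≤ d′ → DegreeAtMost d f → DegreeAtMost d′ f
  degree-weaken d≤d′ h n d′<n = h n (ℕₚ.≤-<-trans d≤d′ d′<n)

  degree-⊕ : ∀ {d f g} → DegreeAtMost d f → DegreeAtMost d g → DegreeAtMost d (f ⊕ g)
  degree-⊕ h h′ n lt = +-cong (h n lt) (h′ n lt)

  degree-⊖ : ∀ {d f} → DegreeAtMost d f → DegreeAtMost d (⊖ f)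
  degree-⊖ h n lt = -‿cong (h n lt)

  degree-const : ∀ a → DegreeAtMost 0 (const a)
  degree-const a (suc n) _ = ≋-refl

  sumBelow-≋0 : ∀ n (f : ℕ → ℤ) → (∀ i → i < n → f i ≋ 0ℤ) → sumBelow n f ≋ 0ℤ
  sumBelow-≋0 n f h = ≋-trans (sumBelow-cong≋ n h) (≡⇒≋ (sumBelow-zero n))

  degree-⊛ : ∀ {a b f g} → DegreeAtMost a f → DegreeAtMost b g → DegreeAtMost (a ℕ.+ b) (f ⊛ g)
  degree-⊛ {a} {b} {f} {g} h h′ n a+b<n = sumBelow-≋0 (suc n) (λ i → f i * g (n ∸ i)) term
    where
    term : ∀ i → i < suc n → f i * g (n ∸ i) ≋ 0ℤ
    term i _ with a <? i
    ... | yes a<i = *-cong (h i a<i) (≋-refl {g (n ∸ i)})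
    ... | no a≮i  = ≋-trans (*-cong (≋-refl {f i}) (h′ (n ∸ i) b<n∸i)) (≡⇒≋ (ℤₚ.*-zeroʳ (f i)))
      where
      i≤a = ℕₚ.≮⇒≥ a≮i
      b<n∸i : b < n ∸ i
      b<n∸i = ℕₚ.+-cancelˡ-< i b (n ∸ i)
        (subst (i ℕ.+ b <_) (sym (ℕₚ.m+[n∸m]≡n (ℕₚ.≤-trans i≤a (ℕₚ.≤-trans (ℕₚ.m≤m+n a b) (ℕₚ.<⇒≤ a+b<n)))))
               (ℕₚ.≤-<-trans (ℕₚ.+-monoˡ-≤ b i≤a) a+b<n))

  degree-shift : ∀ k {a f} → DegreeAtMost a f → DegreeAtMost (k ℕ.+ a) (shift k f)
  degree-shift zero     h               = h
  degree-shift (suc k) h (suc n) (s≤s lt) = degree-shift k h n lt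

  degree-down : ∀ e {a f} → DegreeAtMost (e ℕ.+ a) f → DegreeAtMost a (down e f)
  degree-down e h n lt = h (e ℕ.+ n) (ℕₚ.+-monoʳ-< e lt)

  degree-down-∸ : ∀ e {m f} → DegreeAtMost m f → DegreeAtMost (m ∸ e) (down e f)
  degree-down-∸ e {m} h n m∸e<n = h (e ℕ.+ n) (ℕₚ.≤-<-trans (ℕₚ.m≤n+m∸n m e) (ℕₚ.+-monoʳ-< e m∸e<n))

all-or-least-counterexample : (P : ℕ → Set) → (∀ i → Dec (P i)) → ∀ n →
  (∀ i → i < n → P i) ⊎ Σ ℕ (λ k → k < n × (∀ i → i < k → P i) × ¬ P k)
all-or-least-counterexample P P? zero = inj₁ (λ i ())
all-or-least-counterexample P P? (suc n) with all-or-least-counterexample P P? n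
... | inj₂ (k , k<n , below , ¬Pk) = inj₂ (k , ℕₚ.m<n⇒m<1+n k<n , below , ¬Pk)
... | inj₁ below with P? n
...   | no ¬Pn = inj₂ (n , ℕₚ.≤-refl , below , ¬Pn)
...   | yes Pn = inj₁ λ i i<1+n → extend (ℕₚ.m≤n⇒m<n∨m≡n (ℕₚ.≤-pred i<1+n))
  where extend : ∀ {i} → i < n ⊎ i ≡ n → P i
        extend (inj₁ i<n)  = below _ i<n
        extend (inj₂ refl) = Pn

module PowerSeriesOverField (p : ℕ) (p-prime : Prime p) where
  open PowerSeries p public
  open PrimeField p-prime public

  zero-or-order : ∀ {d f} → DegreeAtMost d f →
    f ≈ zeroPS ⊎ Σ ℕ (λ k → k ≤ d × VanishesBelow k f × ¬ f k ≋ 0ℤ)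
  zero-or-order {d} {f} deg with all-or-least-counterexample (λ i → f i ≋ 0ℤ) (λ i → f i ≋? 0ℤ) (suc d)
  ... | inj₂ (k , k<1+d , below , fk≉0) = inj₂ (k , ℕₚ.≤-pred k<1+d , below , fk≉0)
  ... | inj₁ below = inj₁ (mk≈ λ n → case n (n ≤? d))
    where case : ∀ n → Dec (n ≤ d) → f n ≋ 0ℤ
          case n (yes n≤d) = below n (s≤s n≤d)
          case n (no n≰d)  = deg n (ℕₚ.≰⇒> n≰d)

  ≈0? : ∀ {d f} → DegreeAtMost d f → Dec (f ≈ zeroPS)
  ≈0? deg with zero-or-order deg
  ... | inj₁ f≈0               = yes f≈0
  ... | inj₂ (k , _ , _ , fk≉0) = no (λ f≈0 → fk≉0 (f≈0 ! k))

  coefficient-at-order : ∀ k {G U F} → (G ⊛ U) ≈ F → VanishesBelow k G → G k * U 0 ≋ F k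
  coefficient-at-order k {G} {U} {F} GU≈F G<k≋0 = begin
    G k * U 0                   ≡⟨ sym (trans (⊛-at-0 (down k G) U) (cong (_* U 0) (down-at-0 k G))) ⟩
    (down k G ⊛ U) 0            ≡⟨ sym (shift-at k (down k G ⊛ U)) ⟩
    shift k (down k G ⊛ U) k    ≈⟨ shift-⊛ˡ k (down k G) U ! k ⟨
    (shift k (down k G) ⊛ U) k  ≈⟨ ⊛-cong (shift-down k G G<k≋0) (≈-refl {U}) ! k ⟨
    (G ⊛ U) k                   ≈⟨ GU≈F ! k ⟩
    F k                         ∎
    where open ≋-Reasoning

  vanishesBelow-cancelʳ : ∀ k {G U F} → ¬ U 0 ≋ 0ℤ → (G ⊛ U) ≈ F →
    VanishesBelow k F → VanishesBelow k G
  vanishesBelow-cancelʳ zero     U₀≉0 GU≈F F<k≋0 i ()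
  vanishesBelow-cancelʳ (suc k) {G} {U} {F} U₀≉0 GU≈F F<1+k≋0 = vanishesBelow-suc G<k≋0 Gk≋0
    where
    G<k≋0 : VanishesBelow k G
    G<k≋0 = vanishesBelow-cancelʳ k {G} {U} {F} U₀≉0 GU≈F (λ j j<k → F<1+k≋0 j (ℕₚ.m<n⇒m<1+n j<k))
    Gk≋0 : G k ≋ 0ℤ
    Gk≋0 with x*y≋0⇒x≋0⊎y≋0 (≋-trans (coefficient-at-order k {G} {U} {F} GU≈F G<k≋0) (F<1+k≋0 k ℕₚ.≤-refl))
    ... | inj₁ Gk≋0 = Gk≋0
    ... | inj₂ U₀≋0 = ⊥-elim (U₀≉0 U₀≋0)

  ⊛-≈0-cancelʳ : ∀ {G U} → ¬ U 0 ≋ 0ℤ → (G ⊛ U) ≈ zeroPS → G ≈ zeroPS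
  ⊛-≈0-cancelʳ {G} {U} U₀≉0 GU≈0 =
    mk≈ λ n → vanishesBelow-cancelʳ (suc n) {G} {U} U₀≉0 GU≈0 (λ _ _ → ≋-refl) n ℕₚ.≤-refl

  -- The inverse of U is built coefficient by coefficient: approximation n is
  -- correct in degrees ≤ n, and the coefficient of x^{n+1} is solved for
  -- from the coefficient of x^{n+1} in U⁻¹ U.
  module _ (U : PS) (w : ℤ) (U₀w≋1 : U 0 * w ≋ 1ℤ) where
    private
      next : PS → ℕ → ℤ
      next V n = - w * sumBelow (suc n) (λ j → V j * U (suc n ∸ j))

      approx : ℕ → PS
      approx zero    _ = w
      approx (suc n) i = if does (i ≤? n) then approx n i else next (approx n) n

      inverse : PS
      inverse i = approx i i

      approx-stable : ∀ n i → i ≤ n → approx n i ≡ inverse i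
      approx-stable zero    zero z≤n   = refl
      approx-stable (suc n) i    i≤1+n with ℕₚ.m≤n⇒m<n∨m≡n i≤1+n
      ... | inj₂ refl = refl
      ... | inj₁ i<1+n rewrite dec-true (i ≤? n) (ℕₚ.≤-pred i<1+n) = approx-stable n i (ℕₚ.≤-pred i<1+n)

      inverse-suc : ∀ n → inverse (suc n) ≡ next (approx n) n
      inverse-suc n rewrite dec-false (suc n ≤? n) ℕₚ.1+n≰n = refl

      inverse-⊛ : ∀ n → (inverse ⊛ U) n ≋ onePS n
      inverse-⊛ zero    = ≋-trans (≡⇒≋ (trans (⊛-at-0 inverse U) (ℤₚ.*-comm w (U 0)))) U₀w≋1
      inverse-⊛ (suc n) = begin
        (inverse ⊛ U) (suc n)        ≡⟨ cong₂ _+_ (sumBelow-cong (suc n) (λ j j≤n →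
                                          cong (_* U (suc n ∸ j)) (sym (approx-stable n j (ℕₚ.≤-pred j≤n)))))
                                        (cong₂ _*_ (inverse-suc n) (cong U (ℕₚ.n∸n≡0 n))) ⟩
        S + (- w * S) * U 0          ≡⟨ lemma S w (U 0) ⟩
        S - (U 0 * w) * S            ≈⟨ +-cong (≋-refl {S}) (-‿cong (*-cong U₀w≋1 (≋-refl {S}))) ⟩
        S - 1ℤ * S                   ≡⟨ lemma′ S ⟩
        0ℤ                           ∎
        where
        open ≋-Reasoning
        S = sumBelow (suc n) (λ j → approx n j * U (suc n ∸ j))
        lemma : ∀ S w u → S + (- w * S) * u ≡ S - (u * w) * S
        lemma = solve-∀
        lemma′ : ∀ S → S - 1ℤ * S ≡ 0ℤ
        lemma′ = solve-∀

    invertible : Σ PS λ V → (U ⊛ V) ≈ onePS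
    invertible = inverse , mk≈ λ n → ≋-trans (≡⇒≋ (⊛-comm U inverse n)) (inverse-⊛ n)

  unit-invertible : ∀ U → ¬ U 0 ≋ 0ℤ → Σ PS λ V → (U ⊛ V) ≈ onePS
  unit-invertible U U₀≉0 = invertible U (proj₁ w) (proj₂ w)
    where w = ≉0⇒invertible (U 0) U₀≉0

  -- Synonyms of the operations of Defs (which declares no fixities) with the
  -- usual precedences.
  infixl 6 _⊞_ _⊟_
  infixl 7 _⊠_
  _⊞_ _⊟_ _⊠_ : PS → PS → PS
  f ⊞ g = f ⊕ g
  f ⊟ g = f ⊝ g
  f ⊠ g = f ⊛ g

-- The quadratic equation A + B G + C G² = 0

  Quadratic : PS → PS → PS → PS → PS
  Quadratic A B C G = (A ⊕ (B ⊛ G)) ⊕ ((C ⊛ G) ⊛ G)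

  Quadratic-cong : ∀ {A B C G A′ B′ C′ G′} → A ≈ A′ → B ≈ B′ → C ≈ C′ → G ≈ G′ →
    Quadratic A B C G ≈ Quadratic A′ B′ C′ G′
  Quadratic-cong eA eB eC eG = ⊕-cong (⊕-cong eA (⊛-cong eB eG)) (⊛-cong (⊛-cong eC eG) eG)

  linearFactor : PS → PS → PS → PS
  linearFactor B C G = B ⊞ C ⊠ G

  linearFactor-at-0 : ∀ {B C G} → C 0 * G 0 ≋ 0ℤ → linearFactor B C G 0 ≋ B 0
  linearFactor-at-0 {B} {C} {G} C₀G₀≋0 =
    ≋-trans (+-cong (≋-refl {B 0}) (≋-trans (≡⇒≋ (⊛-at-0 C G)) C₀G₀≋0)) (≡⇒≋ (ℤₚ.+-identityʳ (B 0)))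

  root⇒⊛linearFactor : ∀ {A B C G} → Quadratic A B C G ≈ zeroPS → G ⊠ linearFactor B C G ≈ ⊖ A
  root⇒⊛linearFactor {A} {B} {C} {G} root = begin
    G ⊠ (B ⊞ C ⊠ G)                          ≈⟨ identity₁ A B C G ⟩
    Quadratic A B C G ⊟ A                    ≈⟨ ⊝-cong root (≈-refl {A}) ⟩
    zeroPS ⊟ A                               ≈⟨ ≡⇒≈ (λ n → ℤₚ.+-identityˡ (- A n)) ⟩
    ⊖ A                                      ∎
    where
    open ≈-Reasoning
    identity₁ : ∀ A B C G → G ⊠ (B ⊞ C ⊠ G) ≈ Quadratic A B C G ⊟ A
    identity₁ = solve 4 (λ A B C G → G :* (B :+ C :* G) := (A :+ B :* G :+ C :* G :* G) :- A) ≈-refl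

  quadratic-root-unique : ∀ {A B C G H} → C 0 ≋ 0ℤ → ¬ B 0 ≋ 0ℤ →
    Quadratic A B C G ≈ zeroPS → Quadratic A B C H ≈ zeroPS → G ≈ H
  quadratic-root-unique {A} {B} {C} {G} {H} C₀≋0 B₀≉0 rootG rootH =
    ⊝≈0⇒≈ (⊛-≈0-cancelʳ {G ⊝ H} {B ⊕ (C ⊛ (G ⊕ H))} factor≉0 (begin
      (G ⊟ H) ⊠ (B ⊞ C ⊠ (G ⊞ H))                  ≈⟨ difference A B C G H ⟨
      Quadratic A B C G ⊟ Quadratic A B C H        ≈⟨ ⊝-cong rootG rootH ⟩
      zeroPS ⊟ zeroPS                              ≈⟨ mk≈ (λ _ → ≋-refl) ⟩
      zeroPS                                       ∎))
    where
    open ≈-Reasoning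
    difference : ∀ A B C G H →
      Quadratic A B C G ⊟ Quadratic A B C H ≈ (G ⊟ H) ⊠ (B ⊞ C ⊠ (G ⊞ H))
    difference = solve 5 (λ A B C G H →
      ((A :+ B :* G) :+ (C :* G) :* G) :- ((A :+ B :* H) :+ (C :* H) :* H)
        := (G :- H) :* (B :+ C :* (G :+ H))) ≈-refl
    factor≉0 : ¬ (B ⊕ (C ⊛ (G ⊕ H))) 0 ≋ 0ℤ
    factor≉0 = B₀≉0 ∘ ≋-trans (≋-sym (linearFactor-at-0 {B} {C} {G ⊕ H}
                 (≋-trans (*-cong C₀≋0 (≋-refl {G 0 + H 0})) ≋-refl)))

  module RootOrder {A B C G : PS} (root : Quadratic A B C G ≈ zeroPS)
                   (B₀≉0 : ¬ B 0 ≋ 0ℤ) (C₀G₀≋0 : C 0 * G 0 ≋ 0ℤ) where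

    private
      linearFactor₀≉0 : ¬ linearFactor B C G 0 ≋ 0ℤ
      linearFactor₀≉0 e = B₀≉0 (≋-trans (≋-sym (linearFactor-at-0 {B} {C} {G} C₀G₀≋0)) e)

    A≈0⇒G≈0 : A ≈ zeroPS → G ≈ zeroPS
    A≈0⇒G≈0 A≈0 = ⊛-≈0-cancelʳ {G} {linearFactor B C G} linearFactor₀≉0
      (≈-trans (root⇒⊛linearFactor {A} {B} {C} {G} root) (mk≈ λ n → -‿cong (A≈0 ! n)))

    G≈0⇒A≈0 : G ≈ zeroPS → A ≈ zeroPS
    G≈0⇒A≈0 G≈0 = mk≈ λ n → -≋0⇒≋0 (begin
      - A n                               ≈⟨ root⇒⊛linearFactor {A} {B} {C} {G} root ! n ⟨
      (G ⊠ linearFactor B C G) n          ≈⟨ ⊛-cong G≈0 (≈-refl {linearFactor B C G}) ! n ⟩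
      (zeroPS ⊠ linearFactor B C G) n     ≡⟨ trans (⊛-comm zeroPS (linearFactor B C G) n) (⊛-zeroʳ (linearFactor B C G) n) ⟩
      0ℤ                                  ∎)
      where open ≋-Reasoning

    module _ (k : ℕ) (A<k≋0 : VanishesBelow k A) (Ak≉0 : ¬ A k ≋ 0ℤ) where

      vanishesBelow-order : VanishesBelow k G
      vanishesBelow-order = vanishesBelow-cancelʳ k {G} {linearFactor B C G} {⊖ A} linearFactor₀≉0
        (root⇒⊛linearFactor {A} {B} {C} {G} root) (λ i i<k → -‿cong (A<k≋0 i i<k))

      leading : G k * B 0 ≋ - A k
      leading = ≋-trans (*-cong (≋-refl {G k}) (≋-sym (linearFactor-at-0 {B} {C} {G} C₀G₀≋0)))
        (coefficient-at-order k {G} {linearFactor B C G} {⊖ A}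
          (root⇒⊛linearFactor {A} {B} {C} {G} root) vanishesBelow-order)

      leading≉0 : ¬ G k ≋ 0ℤ
      leading≉0 Gk≋0 = Ak≉0 (-≋0⇒≋0 (≋-trans (≋-sym leading) (≋-trans (*-cong Gk≋0 (≋-refl {B 0})) ≋-refl)))

      2A+GB≉0 : ¬ (+ 2 * A k + G k * B 0 ≋ 0ℤ)
      2A+GB≉0 e = Ak≉0 (≋-trans (≡⇒≋ (sym (lemma (A k)))) (≋-trans (+-cong (≋-refl {+ 2 * A k}) (≋-sym leading)) e))
        where lemma : ∀ a → + 2 * a + - a ≡ a
              lemma = solve-∀

-- One level of a super 1-fraction: G = v x^k / (1 + u x − x^{k+1} G′)

  denominator : ℕ → PS → PS → PS
  denominator k u G′ = (onePS ⊕ shift 1 u) ⊝ shift (suc k) G′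

  record IsLevel (v : ℤ) (k : ℕ) (u G G′ : PS) : Set where
    field
      v≉0      : ¬ v ≋ 0ℤ
      u-degree : ∀ i → k ≤ i → u i ≋ 0ℤ
      equation : (G ⊛ denominator k u G′) ≈ mono v k

  denominator-split : ∀ k W → W 0 ≋ 1ℤ →
    denominator k (truncate k (down 1 W)) (⊖ down (suc k) W) ≈ W
  denominator-split k W W₀≋1 = mk≈ λ { zero → ≋-sym W₀≋1 ; (suc i) → ≡⇒≋ (case i (i <? k)) }
    where
    case : ∀ i → Dec (i < k) → denominator k (truncate k (down 1 W)) (⊖ down (suc k) W) (suc i) ≡ W (suc i)
    case i (yes i<k) = begin
      (0ℤ + truncate k (down 1 W) i) + - shift k (⊖ down (suc k) W) i
        ≡⟨ cong₂ (λ a b → (0ℤ + a) + - b) (truncate-< k (down 1 W) i i<k) (shift-< k _ i i<k) ⟩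
      (0ℤ + W (suc i)) + 0ℤ
        ≡⟨ trans (ℤₚ.+-identityʳ _) (ℤₚ.+-identityˡ _) ⟩
      W (suc i) ∎
      where open ≡-Reasoning
    case i (no i≮k) = begin
      (0ℤ + truncate k (down 1 W) i) + - shift k (⊖ down (suc k) W) i
        ≡⟨ cong₂ (λ a b → (0ℤ + a) + - b) (truncate-≥ k (down 1 W) i k≤i) (shift-≥ k _ i k≤i) ⟩
      0ℤ + - - W (suc (k ℕ.+ (i ∸ k)))
        ≡⟨ trans (ℤₚ.+-identityˡ _) (ℤₚ.neg-involutive _) ⟩
      W (suc (k ℕ.+ (i ∸ k)))
        ≡⟨ cong (λ j → W (suc j)) (ℕₚ.m+[n∸m]≡n k≤i) ⟩
      W (suc i) ∎
      where open ≡-Reasoning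
            k≤i = ℕₚ.≮⇒≥ i≮k

  -- Writing G = x^k H with H(0) = v ≠ 0, the denominator is W = v H⁻¹,
  -- which has constant term 1 and so splits as 1 + u x − x^{k+1} G′.
  level-exists : ∀ k G → VanishesBelow k G → ¬ G k ≋ 0ℤ →
    Σ PS λ u → Σ PS λ G′ → IsLevel (G k) k u G G′
  level-exists k G G<k≋0 Gk≉0 = u , G′ , record
    { v≉0 = Gk≉0
    ; u-degree = λ i k≤i → ≡⇒≋ (truncate-≥ k (down 1 W) i k≤i)
    ; equation = equation }
    where
    v = G k
    H = down k G
    H⁻¹ = unit-invertible H (Gk≉0 ∘ ≋-trans (≡⇒≋ (sym (down-at-0 k G))))
    W = const v ⊛ proj₁ H⁻¹
    HW≈v : H ⊠ W ≈ const v
    HW≈v = begin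
      H ⊠ (const v ⊠ proj₁ H⁻¹)    ≈⟨ solve 3 (λ H c I → H :* (c :* I) := c :* (H :* I)) ≈-refl
                                          H (const v) (proj₁ H⁻¹) ⟩
      const v ⊠ (H ⊠ proj₁ H⁻¹)    ≈⟨ ⊛-cong (≈-refl {const v}) (proj₂ H⁻¹) ⟩
      const v ⊠ onePS              ≈⟨ ≡⇒≈ (λ n → trans (⊛-comm (const v) onePS n) (⊛-identityˡ (const v) n)) ⟩
      const v                      ∎
      where open ≈-Reasoning
    W₀≋1 : W 0 ≋ 1ℤ
    W₀≋1 = *-cancelˡ-≋ Gk≉0 (begin
      v * W 0        ≡⟨ sym (trans (⊛-at-0 H W) (cong (_* W 0) (down-at-0 k G))) ⟩
      (H ⊠ W) 0      ≈⟨ HW≈v ! 0 ⟩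
      v              ≡⟨ sym (ℤₚ.*-identityʳ v) ⟩
      v * 1ℤ         ∎)
      where open ≋-Reasoning
    u  = truncate k (down 1 W)
    G′ = ⊖ down (suc k) W
    equation : G ⊠ denominator k u G′ ≈ mono v k
    equation = begin
      G ⊠ denominator k u G′       ≈⟨ ⊛-cong (shift-down k G G<k≋0) (denominator-split k W W₀≋1) ⟩
      shift k H ⊠ W                ≈⟨ shift-⊛ˡ k H W ⟩
      shift k (H ⊠ W)              ≈⟨ shift-cong k HW≈v ⟩
      mono v k                     ∎
      where open ≈-Reasoning

  denominator₀≉0 : ∀ k u G′ → ¬ denominator k u G′ 0 ≋ 0ℤ
  denominator₀≉0 k u G′ = 1≉0

  module _ {v k u G G′} (level : IsLevel v k u G G′) where
    open IsLevel level

    level-vanishesBelow : VanishesBelow k G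
    level-vanishesBelow = vanishesBelow-cancelʳ k {G} {denominator k u G′} {mono v k}
      (denominator₀≉0 k u G′) equation (λ i i<k → ≡⇒≋ (shift-< k (const v) i i<k))

    level-leading : G k ≋ v
    level-leading = ≋-trans (≡⇒≋ (sym (ℤₚ.*-identityʳ (G k))))
      (≋-trans (coefficient-at-order k {G} {denominator k u G′} {mono v k} equation level-vanishesBelow)
               (≡⇒≋ (shift-at k (const v))))

    level-leading≉0 : ¬ G k ≋ 0ℤ
    level-leading≉0 Gk≋0 = v≉0 (≋-trans (≋-sym level-leading) Gk≋0)

  module _ {v₁ v₂ k₁ k₂ u₁ u₂ G₁ G₂ G₁′ G₂′}
           (level₁ : IsLevel v₁ k₁ u₁ G₁ G₁′) (level₂ : IsLevel v₂ k₂ u₂ G₂ G₂′) (G₁≈G₂ : G₁ ≈ G₂) where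

    level-order-unique : k₁ ≡ k₂
    level-order-unique with ℕ.<-cmp k₁ k₂
    ... | tri< k₁<k₂ _ _ = ⊥-elim (level-leading≉0 level₁
            (≋-trans (G₁≈G₂ ! k₁) (level-vanishesBelow level₂ k₁ k₁<k₂)))
    ... | tri≈ _ k₁≡k₂ _ = k₁≡k₂
    ... | tri> _ _ k₂<k₁ = ⊥-elim (level-leading≉0 level₂
            (≋-trans (≋-sym (G₁≈G₂ ! k₂)) (level-vanishesBelow level₁ k₂ k₂<k₁)))

  -- With the order fixed, G determines the denominator (cancel x^k H, H(0) ≠ 0),
  -- and the denominator determines u and G′ coefficientwise.
  level-unique-at-order : ∀ {v₁ v₂ k u₁ u₂ G₁ G₂ G₁′ G₂′} →
    IsLevel v₁ k u₁ G₁ G₁′ → IsLevel v₂ k u₂ G₂ G₂′ → G₁ ≈ G₂ →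
    (v₁ ≋ v₂) × (u₁ ≈ u₂) × (G₁′ ≈ G₂′)
  level-unique-at-order {v₁} {v₂} {k} {u₁} {u₂} {G₁} {G₂} {G₁′} {G₂′} level₁ level₂ G₁≈G₂ =
    v₁≋v₂ , mk≈ u₁≋u₂ , mk≈ G₁′≋G₂′
    where
    v₁≋v₂ : v₁ ≋ v₂
    v₁≋v₂ = ≋-trans (≋-sym (level-leading level₁)) (≋-trans (G₁≈G₂ ! k) (level-leading level₂))
    D₁ = denominator k u₁ G₁′
    D₂ = denominator k u₂ G₂′
    H  = down k G₁
    G₁≈ : G₁ ≈ shift k H
    G₁≈ = shift-down k G₁ (level-vanishesBelow level₁)
    H₀≉0 : ¬ H 0 ≋ 0ℤ
    H₀≉0 H₀≋0 = level-leading≉0 level₁ (≋-trans (≡⇒≋ (sym (down-at-0 k G₁))) H₀≋0)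
    HD₁≈HD₂ : H ⊠ D₁ ≈ H ⊠ D₂
    HD₁≈HD₂ = shift-injective k (begin
      shift k (H ⊠ D₁)        ≈⟨ shift-⊛ˡ k H D₁ ⟨
      shift k H ⊠ D₁          ≈⟨ ⊛-cong G₁≈ (≈-refl {D₁}) ⟨
      G₁ ⊠ D₁                 ≈⟨ IsLevel.equation level₁ ⟩
      mono v₁ k               ≈⟨ shift-cong k (mk≈ λ { zero → v₁≋v₂ ; (suc n) → ≋-refl }) ⟩
      mono v₂ k               ≈⟨ IsLevel.equation level₂ ⟨
      G₂ ⊠ D₂                 ≈⟨ ⊛-cong (≈-trans (≈-sym G₁≈G₂) G₁≈) (≈-refl {D₂}) ⟩
      shift k H ⊠ D₂          ≈⟨ shift-⊛ˡ k H D₂ ⟩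
      shift k (H ⊠ D₂)        ∎)
      where open ≈-Reasoning
    D₁≈D₂ : D₁ ≈ D₂
    D₁≈D₂ = ⊝≈0⇒≈ (⊛-≈0-cancelʳ {D₁ ⊝ D₂} {H} H₀≉0 (begin
      (D₁ ⊟ D₂) ⊠ H           ≈⟨ solve 3 (λ D₁ D₂ H → (D₁ :- D₂) :* H := H :* D₁ :- H :* D₂) ≈-refl D₁ D₂ H ⟩
      H ⊠ D₁ ⊟ H ⊠ D₂         ≈⟨ ⊝-cong HD₁≈HD₂ (≈-refl {H ⊠ D₂}) ⟩
      H ⊠ D₂ ⊟ H ⊠ D₂         ≈⟨ ≡⇒≈ (λ n → ℤₚ.+-inverseʳ ((H ⊛ D₂) n)) ⟩
      zeroPS                  ∎))
      where open ≈-Reasoning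
    u₁≋u₂ : ∀ i → u₁ i ≋ u₂ i
    u₁≋u₂ i with i <? k
    ... | yes i<k = ≋-trans (≡⇒≋ (sym (low u₁ G₁′))) (≋-trans (D₁≈D₂ ! suc i) (≡⇒≋ (low u₂ G₂′)))
      where low : ∀ u G′ → denominator k u G′ (suc i) ≡ u i
            low u G′ = trans (cong (λ b → (0ℤ + u i) + - b) (shift-< k G′ i i<k))
                             (trans (ℤₚ.+-identityʳ _) (ℤₚ.+-identityˡ _))
    ... | no i≮k = ≋-trans (IsLevel.u-degree level₁ i (ℕₚ.≮⇒≥ i≮k))
                           (≋-sym (IsLevel.u-degree level₂ i (ℕₚ.≮⇒≥ i≮k)))
    high : ∀ {v u G G′} → IsLevel v k u G G′ → ∀ n → denominator k u G′ (suc (k ℕ.+ n)) ≋ - G′ n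
    high {u = u} {G′ = G′} level n = begin
      (0ℤ + u (k ℕ.+ n)) + - shift k G′ (k ℕ.+ n)   ≡⟨ cong (λ b → (0ℤ + u (k ℕ.+ n)) + - b) (shift-+ k G′ n) ⟩
      (0ℤ + u (k ℕ.+ n)) + - G′ n                   ≈⟨ +-cong (+-cong (≋-refl {0ℤ}) (IsLevel.u-degree level (k ℕ.+ n) (ℕₚ.m≤m+n k n)))
                                                               (≋-refl { - G′ n}) ⟩
      0ℤ + - G′ n                                   ≡⟨ ℤₚ.+-identityˡ (- G′ n) ⟩
      - G′ n                                        ∎
      where open ≋-Reasoning
    G₁′≋G₂′ : ∀ n → G₁′ n ≋ G₂′ n
    G₁′≋G₂′ n = subst₂ _≋_ (ℤₚ.neg-involutive (G₁′ n)) (ℤₚ.neg-involutive (G₂′ n))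
      (-‿cong (≋-trans (≋-sym (high level₁ n)) (≋-trans (D₁≈D₂ ! suc (k ℕ.+ n)) (high level₂ n))))

  level-unique : ∀ {v₁ v₂ k₁ k₂ u₁ u₂ G₁ G₂ G₁′ G₂′} →
    IsLevel v₁ k₁ u₁ G₁ G₁′ → IsLevel v₂ k₂ u₂ G₂ G₂′ → G₁ ≈ G₂ →
    (v₁ ≋ v₂) × (k₁ ≡ k₂) × (u₁ ≈ u₂) × (G₁′ ≈ G₂′)
  level-unique {v₂ = v₂} {k₁} {k₂} {u₂ = u₂} {G₂ = G₂} {G₂′ = G₂′} level₁ level₂ G₁≈G₂ =
    v₁≋v₂ , k₁≡k₂ , u₁≈u₂ , G₁′≈G₂′
    where
    k₁≡k₂ = level-order-unique level₁ level₂ G₁≈G₂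
    same-order = level-unique-at-order level₁
      (subst (λ k → IsLevel v₂ k u₂ G₂ G₂′) (sym k₁≡k₂) level₂) G₁≈G₂
    v₁≋v₂ = proj₁ same-order
    u₁≈u₂ = proj₁ (proj₂ same-order)
    G₁′≈G₂′ = proj₂ (proj₂ same-order)

  root-cleared : ∀ {A B C G D V} → Quadratic A B C G ≈ zeroPS → G ⊠ D ≈ V →
    A ⊠ D ⊠ D ⊞ B ⊠ V ⊠ D ⊞ C ⊠ V ⊠ V ≈ zeroPS
  root-cleared {A} {B} {C} {G} {D} {V} root GD≈V = begin
    A ⊠ D ⊠ D ⊞ B ⊠ V ⊠ D ⊞ C ⊠ V ⊠ V
      ≈⟨ ⊕-cong (⊕-cong (≈-refl {A ⊠ D ⊠ D}) (⊛-cong (⊛-cong (≈-refl {B}) GD≈V) (≈-refl {D})))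
                (⊛-cong (⊛-cong (≈-refl {C}) GD≈V) GD≈V) ⟨
    A ⊠ D ⊠ D ⊞ B ⊠ (G ⊠ D) ⊠ D ⊞ C ⊠ (G ⊠ D) ⊠ (G ⊠ D)
      ≈⟨ solve 5 (λ A B C G D → A :* D :* D :+ B :* (G :* D) :* D :+ C :* (G :* D) :* (G :* D)
                                 := D :* D :* (A :+ B :* G :+ C :* G :* G)) ≈-refl A B C G D ⟩
    D ⊠ D ⊠ Quadratic A B C G
      ≈⟨ ⊛-cong (≈-refl {D ⊠ D}) root ⟩
    D ⊠ D ⊠ zeroPS
      ≈⟨ ≡⇒≈ (⊛-zeroʳ (D ⊠ D)) ⟩
    zeroPS ∎
    where open ≈-Reasoning

  -- Substituting G = V / (P − Y), with P = 1 + u x, V = v x^k and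
  -- Y = x^{k+1} G′, into A + B G + C G² = 0 and multiplying by (P − Y)² gives
  -- N − Y L + A Y² = 0 with N = A P² + B V P + C V², L = 2 A P + B V.
  -- If x^{k+d} | A and x^d | B, then x^{k+d} | L and Y L − A Y² is divisible
  -- by x^{2k+d+1}; dividing out leaves A′ + B′ G′ + C′ G′² = 0.
  module Transform (A B C : PS) (k d : ℕ) (v : ℤ) (u : PS) where
    e = k ℕ.+ d
    P = onePS ⊞ shift 1 u
    V = mono v k
    Â = down e A
    B̂ = down d B
    L̂ = const (+ 2) ⊠ Â ⊠ P ⊞ B̂ ⊠ const v
    N = A ⊠ P ⊠ P ⊞ B ⊠ V ⊠ P ⊞ C ⊠ V ⊠ V

    A′ B′ C′ : PS
    A′ = down (suc k ℕ.+ e) N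
    B′ = ⊖ L̂
    C′ = shift (suc k) Â

    B′-at-0 : - B′ 0 ≡ + 2 * A e + v * B d
    B′-at-0 = begin
      - - L̂ 0                        ≡⟨ ℤₚ.neg-involutive (L̂ 0) ⟩
      L̂ 0                            ≡⟨ cong₂ _+_ (trans (⊛-at-0 (const (+ 2) ⊠ Â) P) (cong (_* 1ℤ) (⊛-at-0 (const (+ 2)) Â)))
                                                 (⊛-at-0 B̂ (const v)) ⟩
      + 2 * Â 0 * 1ℤ + B̂ 0 * v       ≡⟨ cong₂ (λ a b → + 2 * a * 1ℤ + b * v) (down-at-0 e A) (down-at-0 d B) ⟩
      + 2 * A e * 1ℤ + B d * v       ≡⟨ lemma (A e) (B d) v ⟩
      + 2 * A e + v * B d            ∎
      where open ≡-Reasoning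
            lemma : ∀ a b v → + 2 * a * 1ℤ + b * v ≡ + 2 * a + v * b
            lemma = solve-∀

    module _ {G G′} (A<e≋0 : VanishesBelow e A) (B<d≋0 : VanishesBelow d B)
             (root : Quadratic A B C G ≈ zeroPS) (level : G ⊠ denominator k u G′ ≈ V) where

      private
        Y = shift (suc k) G′
        R = G′ ⊠ L̂ ⊟ C′ ⊠ G′ ⊠ G′

        A≈ : A ≈ X^ e ⊠ Â
        A≈ = ≈-trans (shift-down e A A<e≋0) (shift≈X^⊛ e Â)

        L≈ : const (+ 2) ⊠ A ⊠ P ⊞ B ⊠ V ≈ X^ e ⊠ L̂
        L≈ = begin
          const (+ 2) ⊠ A ⊠ P ⊞ B ⊠ V
            ≈⟨ ⊕-cong (⊛-cong (⊛-cong (≈-refl {const (+ 2)}) (≈-trans A≈ (⊛-cong (X^-+ k d) (≈-refl {Â})))) (≈-refl {P}))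
                      (⊛-cong (≈-trans (shift-down d B B<d≋0) (shift≈X^⊛ d B̂)) (shift≈X^⊛ k (const v))) ⟩
          const (+ 2) ⊠ (X^ k ⊠ X^ d ⊠ Â) ⊠ P ⊞ X^ d ⊠ B̂ ⊠ (X^ k ⊠ const v)
            ≈⟨ solve 6 (λ Xk Xd Â P B̂ c → con (+ 2) :* (Xk :* Xd :* Â) :* P :+ Xd :* B̂ :* (Xk :* c)
                                         := Xk :* Xd :* (con (+ 2) :* Â :* P :+ B̂ :* c)) ≈-refl
                       (X^ k) (X^ d) Â P B̂ (const v) ⟩
          X^ k ⊠ X^ d ⊠ L̂
            ≈⟨ ⊛-cong (X^-+ k d) (≈-refl {L̂}) ⟨
          X^ e ⊠ L̂ ∎
          where open ≈-Reasoning

        N≈ : N ≈ shift (suc k ℕ.+ e) R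
        N≈ = begin
          N
            ≈⟨ solve 6 (λ A B C P Y V → A :* P :* P :+ B :* V :* P :+ C :* V :* V
                 := (A :* (P :- Y) :* (P :- Y) :+ B :* V :* (P :- Y) :+ C :* V :* V)
                    :+ Y :* (con (+ 2) :* A :* P :+ B :* V) :- A :* Y :* Y) ≈-refl A B C P Y V ⟩
          (A ⊠ (P ⊟ Y) ⊠ (P ⊟ Y) ⊞ B ⊠ V ⊠ (P ⊟ Y) ⊞ C ⊠ V ⊠ V) ⊞ Y ⊠ (const (+ 2) ⊠ A ⊠ P ⊞ B ⊠ V) ⊟ A ⊠ Y ⊠ Y
            ≈⟨ ⊝-cong (⊕-cong (≈-trans (root-cleared {A} {B} {C} {G} {P ⊟ Y} {V} root level) zeroPS≈const0)
                              (⊛-cong (shift≈X^⊛ (suc k) G′) L≈))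
                      (⊛-cong (⊛-cong A≈ (shift≈X^⊛ (suc k) G′)) (shift≈X^⊛ (suc k) G′)) ⟩
          const 0ℤ ⊞ X^ (suc k) ⊠ G′ ⊠ (X^ e ⊠ L̂) ⊟ X^ e ⊠ Â ⊠ (X^ (suc k) ⊠ G′) ⊠ (X^ (suc k) ⊠ G′)
            ≈⟨ solve 5 (λ Xs Xe G′ L̂ Â →
                 con 0ℤ :+ Xs :* G′ :* (Xe :* L̂) :- Xe :* Â :* (Xs :* G′) :* (Xs :* G′)
                 := Xs :* Xe :* (G′ :* L̂ :- (Xs :* Â) :* G′ :* G′)) ≈-refl
                 (X^ (suc k)) (X^ e) G′ L̂ Â ⟩
          X^ (suc k) ⊠ X^ e ⊠ (G′ ⊠ L̂ ⊟ (X^ (suc k) ⊠ Â) ⊠ G′ ⊠ G′)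
            ≈⟨ ⊛-cong (X^-+ (suc k) e) (⊝-cong (≈-refl {G′ ⊠ L̂})
                 (⊛-cong (⊛-cong (shift≈X^⊛ (suc k) Â) (≈-refl {G′})) (≈-refl {G′}))) ⟨
          X^ (suc k ℕ.+ e) ⊠ R
            ≈⟨ shift≈X^⊛ (suc k ℕ.+ e) R ⟨
          shift (suc k ℕ.+ e) R ∎
          where open ≈-Reasoning

      transformed-root : Quadratic A′ B′ C′ G′ ≈ zeroPS
      transformed-root = begin
        Quadratic A′ B′ C′ G′
          ≈⟨ Quadratic-cong (≈-trans (down-cong (suc k ℕ.+ e) N≈) (down-shift (suc k ℕ.+ e) R))
                            (≈-refl {B′}) (≈-refl {C′}) (≈-refl {G′}) ⟩
        Quadratic R (⊖ L̂) C′ G′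
          ≈⟨ solve 3 (λ L̂ C′ G′ → G′ :* L̂ :- C′ :* G′ :* G′ :+ (:- L̂) :* G′ :+ C′ :* G′ :* G′ := con 0ℤ)
                     ≈-refl L̂ C′ G′ ⟩
        const 0ℤ
          ≈⟨ zeroPS≈const0 ⟨
        zeroPS ∎
        where open ≈-Reasoning

    module _ {m} (k≤m : k ≤ m) (u-degree : ∀ i → k ≤ i → u i ≋ 0ℤ)
             (degA : DegreeAtMost m A) (degB : DegreeAtMost m B) (degC : DegreeAtMost (suc m) C) where

      private
        ≤-by : ∀ a b c → b ≡ a ℕ.+ c → a ≤ b
        ≤-by a b c b≡a+c = subst (a ≤_) (sym b≡a+c) (ℕₚ.m≤m+n a c)

        degP : DegreeAtMost k P
        degP (suc i) (s≤s k≤i) = ≋-trans (≡⇒≋ (ℤₚ.+-identityˡ (u i))) (u-degree i k≤i)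

        degV : DegreeAtMost (k ℕ.+ 0) V
        degV = degree-shift k (degree-const v)

      degree-A′ : DegreeAtMost m A′
      degree-A′ = degree-down (suc k ℕ.+ e) (degree-⊕ (degree-⊕
          (degree-weaken (≤-by _ _ (suc d) (eq₁ m k d)) (degree-⊛ (degree-⊛ degA degP) degP))
          (degree-weaken (≤-by _ _ (suc d) (eq₂ m k d)) (degree-⊛ (degree-⊛ degB degV) degP)))
          (degree-weaken (≤-by _ _ d (eq₃ m k d)) (degree-⊛ (degree-⊛ degC degV) degV)))
        where
        eq₁ : ∀ m k d → (suc k ℕ.+ (k ℕ.+ d)) ℕ.+ m ≡ ((m ℕ.+ k) ℕ.+ k) ℕ.+ suc d
        eq₁ = ℕ-solver.solve-∀
        eq₂ : ∀ m k d → (suc k ℕ.+ (k ℕ.+ d)) ℕ.+ m ≡ ((m ℕ.+ (k ℕ.+ 0)) ℕ.+ k) ℕ.+ suc d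
        eq₂ = ℕ-solver.solve-∀
        eq₃ : ∀ m k d → (suc k ℕ.+ (k ℕ.+ d)) ℕ.+ m ≡ ((suc m ℕ.+ (k ℕ.+ 0)) ℕ.+ (k ℕ.+ 0)) ℕ.+ d
        eq₃ = ℕ-solver.solve-∀

      private
        m∸e+k≤m : (m ∸ e) ℕ.+ k ≤ m
        m∸e+k≤m = ℕₚ.≤-trans (ℕₚ.+-monoˡ-≤ k (ℕₚ.∸-monoʳ-≤ m (ℕₚ.m≤m+n k d))) (ℕₚ.≤-reflexive (ℕₚ.m∸n+n≡m k≤m))

      degree-B′ : DegreeAtMost m B′
      degree-B′ = degree-⊖ (degree-⊕
          (degree-weaken m∸e+k≤m (degree-⊛ (degree-⊛ (degree-const (+ 2)) (degree-down-∸ e degA)) degP))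
          (degree-weaken (ℕₚ.≤-trans (ℕₚ.≤-reflexive (ℕₚ.+-identityʳ (m ∸ d))) (ℕₚ.m∸n≤m m d))
                         (degree-⊛ (degree-down-∸ d degB) (degree-const v))))

      degree-C′ : DegreeAtMost (suc m) C′
      degree-C′ = degree-weaken (s≤s (subst (_≤ m) (ℕₚ.+-comm (m ∸ e) k) m∸e+k≤m))
                                (degree-shift (suc k) (degree-down-∸ e degA))

-- The expansion algorithm on reduced equations

  -- The invariant of the algorithm: G is the root, unique since B(0) ≠ 0 and
  -- C(0) = 0, of an equation whose coefficients range over a finite set.
  record Reduced (m : ℕ) : Set where
    constructor reduced
    field
      A B C G  : PS
      degree-A : DegreeAtMost m A
      degree-B : DegreeAtMost m B
      degree-C : DegreeAtMost (suc m) C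
      root     : Quadratic A B C G ≈ zeroPS
      B₀≉0     : ¬ B 0 ≋ 0ℤ
      C₀≋0     : C 0 ≋ 0ℤ

    C₀G₀≋0 : C 0 * G 0 ≋ 0ℤ
    C₀G₀≋0 = *-cong C₀≋0 (≋-refl {G 0})

  record Move (m : ℕ) : Set where
    constructor move
    field
      v    : ℤ
      k    : ℕ
      u    : PS
      next : Reduced m

  record ReducedLevel (m : ℕ) (G : PS) : Set where
    field
      step  : Move m
      level : IsLevel (Move.v step) (Move.k step) (Move.u step) G (Reduced.G (Move.next step))

  reduced-level : ∀ {m A B C G} k d → k ≤ m →
    DegreeAtMost m A → DegreeAtMost m B → DegreeAtMost (suc m) C → Quadratic A B C G ≈ zeroPS →
    VanishesBelow k G → ¬ G k ≋ 0ℤ → VanishesBelow (k ℕ.+ d) A → VanishesBelow d B →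
    ¬ (+ 2 * A (k ℕ.+ d) + G k * B d ≋ 0ℤ) → ReducedLevel m G
  reduced-level {m} {A} {B} {C} {G} k d k≤m degA degB degC root G<k≋0 Gk≉0 A<e≋0 B<d≋0 2A+GB≉0 = record
    { step  = move (G k) k u (reduced A′ B′ C′ G′
                (degree-A′ k≤m u-degree degA degB degC) (degree-B′ k≤m u-degree degA degB degC)
                (degree-C′ k≤m u-degree degA degB degC)
                (transformed-root {G} {G′} A<e≋0 B<d≋0 root equation) B′₀≉0 ≋-refl)
    ; level = level }
    where
    u     = proj₁ (level-exists k G G<k≋0 Gk≉0)
    G′    = proj₁ (proj₂ (level-exists k G G<k≋0 Gk≉0))
    level = proj₂ (proj₂ (level-exists k G G<k≋0 Gk≉0))
    open IsLevel level
    open Transform A B C k d (G k) u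
    B′₀≉0 : ¬ B′ 0 ≋ 0ℤ
    B′₀≉0 B′₀≋0 = 2A+GB≉0 (subst (_≋ 0ℤ) B′-at-0 (-‿cong B′₀≋0))

  root-step : ∀ {m A B C G} → DegreeAtMost m A → DegreeAtMost m B → DegreeAtMost (suc m) C →
    Quadratic A B C G ≈ zeroPS → ¬ B 0 ≋ 0ℤ → C 0 * G 0 ≋ 0ℤ → A ≈ zeroPS ⊎ ReducedLevel m G
  root-step {m} {A} {B} {C} {G} degA degB degC root B₀≉0 C₀G₀≋0 =
    map₂-⊎ (λ (k , k≤m , A<k≋0 , Ak≉0) → reduced-level {m} {A} {B} {C} {G} k 0 k≤m degA degB degC root
      (vanishesBelow-order k A<k≋0 Ak≉0) (leading≉0 k A<k≋0 Ak≉0)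
      (subst (λ e → VanishesBelow e A) (sym (ℕₚ.+-identityʳ k)) A<k≋0) (λ i ())
      (subst (λ e → ¬ (+ 2 * A e + G k * B 0 ≋ 0ℤ)) (sym (ℕₚ.+-identityʳ k)) (2A+GB≉0 k A<k≋0 Ak≉0)))
      (zero-or-order {m} {A} degA)
    where open RootOrder {A} {B} {C} {G} root B₀≉0 C₀G₀≋0

  reduced-next : ∀ {m} (S : Reduced m) → Reduced.A S ≈ zeroPS ⊎ ReducedLevel m (Reduced.G S)
  reduced-next {m} S = root-step {m} {A} {B} {C} {G} degree-A degree-B degree-C root B₀≉0 C₀G₀≋0
    where open Reduced S

  private
    move-by : ∀ {m} (S : Reduced m) → Reduced.A S ≈ zeroPS ⊎ ReducedLevel m (Reduced.G S) → Move m
    move-by S (inj₁ _)    = move 0ℤ 0 zeroPS S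
    move-by S (inj₂ next) = ReducedLevel.step next

    move-by-level : ∀ {m} (S : Reduced m) (next : Reduced.A S ≈ zeroPS ⊎ ReducedLevel m (Reduced.G S)) →
      ¬ Reduced.A S ≈ zeroPS →
      IsLevel (Move.v (move-by S next)) (Move.k (move-by S next)) (Move.u (move-by S next))
              (Reduced.G S) (Reduced.G (Move.next (move-by S next)))
    move-by-level S (inj₁ A≈0)  A≉0 = ⊥-elim (A≉0 A≈0)
    move-by-level S (inj₂ next) _   = ReducedLevel.level next

  opaque
    -- When A = 0 the algorithm has stopped; the move is then a dummy one.
    advance : ∀ {m} → Reduced m → Move m
    advance S = move-by S (reduced-next S)

    advance-level : ∀ {m} (S : Reduced m) → ¬ Reduced.A S ≈ zeroPS →
      IsLevel (Move.v (advance S)) (Move.k (advance S)) (Move.u (advance S))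
              (Reduced.G S) (Reduced.G (Move.next (advance S)))
    advance-level S = move-by-level S (reduced-next S)

  private instance
    p≢0 : ℕ.NonZero p
    p≢0 = prime⇒nonZero p-prime

  residue : ℤ → Fin p
  residue a = fromℕ< (n%ℕd<d a p)

  residue-injective : ∀ a b → residue a ≡ residue b → a ≋ b
  residue-injective a b eq = mk≋ (ℤ∣.divides (a /ℕ p - b /ℕ p) (begin
    a - b
      ≡⟨ cong₂ _-_ (a≡a%ℕn+[a/ℕn]*n a p) (a≡a%ℕn+[a/ℕn]*n b p) ⟩
    (+ (a %ℕ p) + (a /ℕ p) * + p) - (+ (b %ℕ p) + (b /ℕ p) * + p)
      ≡⟨ cong (λ r → (+ r + (a /ℕ p) * + p) - (+ (b %ℕ p) + (b /ℕ p) * + p)) same-remainder ⟩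
    (+ (b %ℕ p) + (a /ℕ p) * + p) - (+ (b %ℕ p) + (b /ℕ p) * + p)
      ≡⟨ lemma (+ (b %ℕ p)) (a /ℕ p) (b /ℕ p) (+ p) ⟩
    (a /ℕ p - b /ℕ p) * + p ∎))
    where
    open ≡-Reasoning
    same-remainder : a %ℕ p ≡ b %ℕ p
    same-remainder = trans (sym (Finₚ.toℕ-fromℕ< (n%ℕd<d a p)))
                     (trans (cong toℕ eq) (Finₚ.toℕ-fromℕ< (n%ℕd<d b p)))
    lemma : ∀ r x y q → (r + x * q) - (r + y * q) ≡ (x - y) * q
    lemma = solve-∀

  digits : (ℕ → Fin p) → (L : ℕ) → Fin (p ^ L)
  digits f zero    = Fin.zero
  digits f (suc L) = combine (f L) (digits f L)

  digits-injective : ∀ f g L → digits f L ≡ digits g L → ∀ i → i < L → f i ≡ g i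
  digits-injective f g (suc L) eq i i<1+L with ℕₚ.m≤n⇒m<n∨m≡n (ℕₚ.≤-pred i<1+L)
  ... | inj₁ i<L = digits-injective f g L (Finₚ.combine-injectiveʳ (f L) (digits f L) (g L) (digits g L) eq) i i<L
  ... | inj₂ refl = Finₚ.combine-injectiveˡ (f L) (digits f L) (g L) (digits g L) eq

  polynomialCode : ∀ d → PS → Fin (p ^ suc d)
  polynomialCode d f = digits (λ i → residue (f i)) (suc d)

  polynomialCode-injective : ∀ {d f g} → DegreeAtMost d f → DegreeAtMost d g →
    polynomialCode d f ≡ polynomialCode d g → f ≈ g
  polynomialCode-injective {d} {f} {g} degf degg eq = mk≈ λ n → case n (n ≤? d)
    where
    case : ∀ n → Dec (n ≤ d) → f n ≋ g n
    case n (yes n≤d) = residue-injective (f n) (g n)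
      (digits-injective (λ i → residue (f i)) (λ i → residue (g i)) (suc d) eq n (s≤s n≤d))
    case n (no n≰d) = ≋-trans (degf n (ℕₚ.≰⇒> n≰d)) (≋-sym (degg n (ℕₚ.≰⇒> n≰d)))

  reducedCount : ℕ → ℕ
  reducedCount m = p ^ suc (suc m) ℕ.* (p ^ suc (suc m) ℕ.* p ^ suc (suc m))

  -- Only A, B, C are coded: they determine G by quadratic-root-unique.
  reducedCode : ∀ {m} → Reduced m → Fin (reducedCount m)
  reducedCode {m} S = combine (polynomialCode (suc m) A) (combine (polynomialCode (suc m) B) (polynomialCode (suc m) C))
    where open Reduced S

  reducedCode-injective : ∀ {m} (S S′ : Reduced m) → reducedCode S ≡ reducedCode S′ → Reduced.G S ≈ Reduced.G S′
  reducedCode-injective {m} S S′ eq =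
    quadratic-root-unique {A S} {B S} {C S} {G S} {G S′} (C₀≋0 S) (B₀≉0 S) (root S)
    (≈-trans (Quadratic-cong {G = G S′} A≈ B≈ C≈ (≈-refl {G S′})) (root S′))
    where
    open Reduced
    eq₂ = Finₚ.combine-injectiveʳ (polynomialCode (suc m) (A S)) _ (polynomialCode (suc m) (A S′)) _ eq
    A≈ = polynomialCode-injective (degree-weaken (ℕₚ.n≤1+n m) (degree-A S)) (degree-weaken (ℕₚ.n≤1+n m) (degree-A S′))
           (Finₚ.combine-injectiveˡ (polynomialCode (suc m) (A S)) _ (polynomialCode (suc m) (A S′)) _ eq)
    B≈ = polynomialCode-injective (degree-weaken (ℕₚ.n≤1+n m) (degree-B S)) (degree-weaken (ℕₚ.n≤1+n m) (degree-B S′))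
           (Finₚ.combine-injectiveˡ (polynomialCode (suc m) (B S)) _ (polynomialCode (suc m) (B S′)) _ eq₂)
    C≈ = polynomialCode-injective (degree-C S) (degree-C S′)
           (Finₚ.combine-injectiveʳ (polynomialCode (suc m) (B S)) _ (polynomialCode (suc m) (B S′)) _ eq₂)

-- Ultimate periodicity of the algorithm

  toLevel : ∀ {v k u G j} → IsLevel (v j) (k j) (u (suc j)) (G j) (G (suc j)) → Level p v k u G j
  toLevel {v} {k} {u} {G} {j} lvl = record
    { v-nonzero = λ v≡0 → v≉0 (≡[]⇒≋ v≡0)
    ; u-deg     = λ i k≤i → ≋⇒≡[] (u-degree i k≤i)
    ; equation  = λ n → ≋⇒≡[] (equation ! n) }
    where open IsLevel lvl

  module Orbit {m} (S₀ : Reduced m) where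

    state : ℕ → Reduced m
    state zero    = S₀
    state (suc t) = Move.next (advance (state t))

    G : ℕ → PS
    G t = Reduced.G (state t)

    v : ℕ → ℤ
    v t = Move.v (advance (state t))

    k : ℕ → ℕ
    k t = Move.k (advance (state t))

    u : ℕ → PS
    u zero    = zeroPS
    u (suc t) = Move.u (advance (state t))

    Live : ℕ → Set
    Live t = ¬ Reduced.A (state t) ≈ zeroPS

    live? : ∀ t → Dec (Live t)
    live? t with ≈0? (Reduced.degree-A (state t))
    ... | yes A≈0 = no (λ A≉0 → A≉0 A≈0)
    ... | no A≉0  = yes A≉0

    level : ∀ t → Live t → IsLevel (v t) (k t) (u (suc t)) (G t) (G (suc t))
    level t = advance-level (state t)

    private
      module Root (t : ℕ) = RootOrder {Reduced.A (state t)} {Reduced.B (state t)} {Reduced.C (state t)} {G t}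
        (Reduced.root (state t)) (Reduced.B₀≉0 (state t)) (Reduced.C₀G₀≋0 (state t))

    dead⇒G≈0 : ∀ t → ¬ Live t → G t ≈ zeroPS
    dead⇒G≈0 t dead with live? t
    ... | yes live = ⊥-elim (dead live)
    ... | no  dead′ with ≈0? (Reduced.degree-A (state t))
    ...   | yes A≈0 = Root.A≈0⇒G≈0 t A≈0
    ...   | no  A≉0 = ⊥-elim (dead A≉0)

    live-≈ : ∀ a b → G a ≈ G b → Live a → Live b
    live-≈ a b Ga≈Gb live-a A≈0 = live-a (Root.G≈0⇒A≈0 a (≈-trans Ga≈Gb (Root.A≈0⇒G≈0 b A≈0)))

    SameLevel : ℕ → ℕ → Set
    SameLevel a b = (v a ≋ v b) × (k a ≡ k b) × (u (suc a) ≈ u (suc b))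

    same-level : ∀ a b → Live a → G a ≈ G b → SameLevel a b
    same-level a b live-a Ga≈Gb = v≋ , k≡ , u≈
      where
      unique = level-unique (level a live-a) (level b (live-≈ a b Ga≈Gb live-a)) Ga≈Gb
      v≋ = proj₁ unique
      k≡ = proj₁ (proj₂ unique)
      u≈ = proj₁ (proj₂ (proj₂ unique))

    -- Once two live states have the same G, their whole futures agree.
    module Periodic (i j : ℕ) (i<j : i < j) (Gi≈Gj : G i ≈ G j) (live≤j : ∀ t → t < suc j → Live t) where

      T : ℕ
      T = j ∸ i

      j≡i+T : j ≡ i ℕ.+ T
      j≡i+T = sym (ℕₚ.m+[n∸m]≡n (ℕₚ.<⇒≤ i<j))

      Agree : ℕ → Set
      Agree s = Live (i ℕ.+ s) × G (i ℕ.+ s) ≈ G (j ℕ.+ s)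

      private
        Below : ℕ → Set
        Below s = ∀ {s′} → s′ < s → Agree s′

        same : ∀ s → Below s → G (i ℕ.+ s) ≈ G (j ℕ.+ s)
        same zero     _   = subst₂ (λ a b → G a ≈ G b) (sym (ℕₚ.+-identityʳ i)) (sym (ℕₚ.+-identityʳ j)) Gi≈Gj
        same (suc s′) rec = subst₂ (λ a b → G a ≈ G b) (sym (ℕₚ.+-suc i s′)) (sym (ℕₚ.+-suc j s′))
          (proj₂ (proj₂ (proj₂ (level-unique (level (i ℕ.+ s′) live-i)
            (level (j ℕ.+ s′) (live-≈ (i ℕ.+ s′) (j ℕ.+ s′) agree-G live-i)) agree-G))))
          where
          live-i  = proj₁ (rec ℕₚ.≤-refl)
          agree-G = proj₂ (rec ℕₚ.≤-refl)

        -- Beyond j, liveness is inherited from a strictly earlier index.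
        live : ∀ s → Below s → Live (i ℕ.+ s)
        live s rec with i ℕ.+ s ≤? j
        ... | yes i+s≤j = live≤j (i ℕ.+ s) (s≤s i+s≤j)
        ... | no  i+s≰j = subst Live (ℕₚ.m+[n∸m]≡n (ℕₚ.<⇒≤ j<i+s))
            (live-≈ (i ℕ.+ s′) (j ℕ.+ s′) (proj₂ (rec s′<s)) (proj₁ (rec s′<s)))
          where
          j<i+s = ℕₚ.≰⇒> i+s≰j
          s′ = (i ℕ.+ s) ∸ j
          s′<s : s′ < s
          s′<s = ℕₚ.+-cancelˡ-< j s′ s
            (subst (_< j ℕ.+ s) (sym (ℕₚ.m+[n∸m]≡n (ℕₚ.<⇒≤ j<i+s))) (ℕₚ.+-monoˡ-< s i<j))

      agree : ∀ s → Agree s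
      agree = <-rec Agree (λ s rec → live s rec , same s rec)

      live-all : ∀ t → Live t
      live-all t with t ≤? j
      ... | yes t≤j = live≤j t (s≤s t≤j)
      ... | no  t≰j = subst Live (ℕₚ.m+[n∸m]≡n i≤t) (proj₁ (agree (t ∸ i)))
        where i≤t = ℕₚ.<⇒≤ (ℕₚ.<-trans i<j (ℕₚ.≰⇒> t≰j))

      period : ∀ t → i ≤ t → SameLevel (t ℕ.+ T) t
      period t i≤t = subst₂ SameLevel j+s≡t+T (ℕₚ.m+[n∸m]≡n i≤t)
        (same-level (j ℕ.+ s) (i ℕ.+ s) (live-≈ (i ℕ.+ s) (j ℕ.+ s) (proj₂ (agree s)) (proj₁ (agree s)))
                    (≈-sym (proj₂ (agree s))))
        where
        s = t ∸ i
        lemma : ∀ i T s → i ℕ.+ T ℕ.+ s ≡ i ℕ.+ s ℕ.+ T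
        lemma = ℕ-solver.solve-∀
        j+s≡t+T : j ℕ.+ s ≡ t ℕ.+ T
        j+s≡t+T = trans (cong (ℕ._+ s) j≡i+T) (trans (lemma i T s) (cong (ℕ._+ T) (ℕₚ.m+[n∸m]≡n i≤t)))

    finite-expansion : ∀ N → (∀ t → t < N → Live t) → ¬ Live N → FiniteExpansion p (G 0)
    finite-expansion N live<N dead =
      N , v , k , u , G , ≈⇒≈[] (≈-refl {G 0}) , (λ t t<N → toLevel (level t (live<N t t<N))) ,
      ≈⇒≈[] (dead⇒G≈0 N dead)

    periodic-expansion : ∀ i j (i<j : i < j) → G i ≈ G j → (∀ t → t < suc j → Live t) →
      PeriodicInfiniteExpansion p (G 0)
    periodic-expansion i j i<j Gi≈Gj live≤j =
      v , k , u , G , ≈⇒≈[] (≈-refl {G 0}) , (λ t → toLevel (level t (live-all t))) ,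
      i , T , ℕₚ.m<n⇒0<n∸m i<j ,
      λ t i≤t → ≋⇒≡[] (proj₁ (period t i≤t)) , proj₁ (proj₂ (period t i≤t)) ,
                ≈⇒≈[] (proj₂ (proj₂ (period t i≤t)))
      where open Periodic i j i<j Gi≈Gj live≤j

    -- Among the first reducedCount m + 1 states two share their code; either
    -- the algorithm stops before the later one, or it is periodic from there on.
    expansion : HasUltPeriodicSuper1Fraction p (G 0)
    expansion = repeat (Finₚ.pigeonhole (ℕₚ.n<1+n (reducedCount m)) (λ t → reducedCode (state (toℕ t))))
      where
      repeat : (Σ (Fin (suc (reducedCount m))) λ i → Σ (Fin (suc (reducedCount m))) λ j →
                 toℕ i < toℕ j × reducedCode (state (toℕ i)) ≡ reducedCode (state (toℕ j))) →
               HasUltPeriodicSuper1Fraction p (G 0)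
      repeat (i , j , i<j , same-code) = map-⊎
        (λ (N , _ , live<N , dead) → finite-expansion N live<N dead)
        (periodic-expansion (toℕ i) (toℕ j) i<j (reducedCode-injective (state (toℕ i)) (state (toℕ j)) same-code))
        (swap (all-or-least-counterexample Live live? (suc (toℕ j))))

  IsLevel-tail-cong : ∀ {v k u G G₁ G₂} → G₁ ≈ G₂ → IsLevel v k u G G₂ → IsLevel v k u G G₁
  IsLevel-tail-cong {k = k} {u} {G} G₁≈G₂ level = record
    { v≉0 = v≉0 ; u-degree = u-degree
    ; equation = ≈-trans (⊛-cong (≈-refl {G}) (⊝-cong (≈-refl {onePS ⊕ shift 1 u}) (shift-cong (suc k) G₁≈G₂)))
                         equation }
    where open IsLevel level

  prepend : ∀ {v₀ k₀ u₀ F G₁} → IsLevel v₀ k₀ u₀ F G₁ →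
    HasUltPeriodicSuper1Fraction p G₁ → HasUltPeriodicSuper1Fraction p F
  prepend {v₀} {k₀} {u₀} {F} {G₁} level (inj₁ (N , v , k , u , G , G₀≈G₁ , levels , G_N≈0)) =
    inj₁ (suc N , cons v₀ v , cons k₀ k , cons zeroPS (cons u₀ (u ∘ suc)) , cons F G , ≈⇒≈[] (≈-refl {F}) ,
          levels′ , G_N≈0)
    where
    levels′ : ∀ j → j < suc N → Level p (cons v₀ v) (cons k₀ k) (cons zeroPS (cons u₀ (u ∘ suc))) (cons F G) j
    levels′ zero    _         =
      toLevel {j = 0} (IsLevel-tail-cong {G₁ = G 0} {G₁} (≈[]⇒≈ {G 0} {G₁} G₀≈G₁) level)
    levels′ (suc j) (s≤s j<N) = record { Level (levels j j<N) }
  prepend {v₀} {k₀} {u₀} {F} {G₁} level (inj₂ (v , k , u , G , G₀≈G₁ , levels , n₀ , T , 1≤T , periodic)) =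
    inj₂ (cons v₀ v , cons k₀ k , cons zeroPS (cons u₀ (u ∘ suc)) , cons F G , ≈⇒≈[] (≈-refl {F}) ,
          levels′ , suc n₀ , T , 1≤T , λ { (suc j) (s≤s n₀≤j) → periodic j n₀≤j })
    where
    levels′ : ∀ j → Level p (cons v₀ v) (cons k₀ k) (cons zeroPS (cons u₀ (u ∘ suc))) (cons F G) j
    levels′ zero    = toLevel {j = 0} (IsLevel-tail-cong {G₁ = G 0} {G₁} (≈[]⇒≈ {G 0} {G₁} G₀≈G₁) level)
    levels′ (suc j) = record { Level (levels j) }

  level-expansion : ∀ {m G} → ReducedLevel m G → HasUltPeriodicSuper1Fraction p G
  level-expansion next = prepend (ReducedLevel.level next) (Orbit.expansion (Move.next (ReducedLevel.step next)))

  zero-expansion : ∀ {G} → G ≈ zeroPS → HasUltPeriodicSuper1Fraction p G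
  zero-expansion {G} G≈0 =
    inj₁ (0 , (λ _ → 0ℤ) , (λ _ → 0) , (λ _ → zeroPS) , (λ _ → G) , ≈⇒≈[] (≈-refl {G}) ,
          (λ _ ()) , ≈⇒≈[] G≈0)

  root-expansion : ∀ {m A B C G} → DegreeAtMost m A → DegreeAtMost m B → DegreeAtMost (suc m) C →
    Quadratic A B C G ≈ zeroPS → ¬ B 0 ≋ 0ℤ → C 0 * G 0 ≋ 0ℤ → HasUltPeriodicSuper1Fraction p G
  root-expansion {m} {A} {B} {C} {G} degA degB degC root B₀≉0 C₀G₀≋0 =
    [ zero-expansion ∘ RootOrder.A≈0⇒G≈0 {A} {B} {C} {G} root B₀≉0 C₀G₀≋0 , level-expansion ]′
      (root-step {m} {A} {B} {C} {G} degA degB degC root B₀≉0 C₀G₀≋0)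

-- The cases of the theorem

  ⊛-square-at-order : ∀ j C F → VanishesBelow j F → ((C ⊛ F) ⊛ F) (j ℕ.+ j) ≋ C 0 * F j * F j
  ⊛-square-at-order j C F F<j≋0 = begin
    ((C ⊠ F) ⊠ F) (j ℕ.+ j)                             ≈⟨ ⊛-cong (⊛-cong (≈-refl {C}) F≈) F≈ ! (j ℕ.+ j) ⟩
    ((C ⊠ shift j F̂) ⊠ shift j F̂) (j ℕ.+ j)             ≈⟨ ⊛-cong (shift-⊛ʳ j F̂ C) (≈-refl {shift j F̂}) ! (j ℕ.+ j) ⟩
    (shift j (C ⊠ F̂) ⊠ shift j F̂) (j ℕ.+ j)             ≈⟨ shift-⊛-shift j j (C ⊠ F̂) F̂ ! (j ℕ.+ j) ⟩
    shift (j ℕ.+ j) ((C ⊠ F̂) ⊠ F̂) (j ℕ.+ j)             ≡⟨ shift-at (j ℕ.+ j) ((C ⊠ F̂) ⊠ F̂) ⟩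
    ((C ⊠ F̂) ⊠ F̂) 0                                     ≡⟨ trans (⊛-at-0 (C ⊠ F̂) F̂) (cong (_* F̂ 0) (⊛-at-0 C F̂)) ⟩
    C 0 * F̂ 0 * F̂ 0                                     ≡⟨ cong (λ x → C 0 * x * x) (down-at-0 j F) ⟩
    C 0 * F j * F j                                     ∎
    where
    open ≋-Reasoning
    F̂ = down j F
    F≈ = shift-down j F F<j≋0

  module PureSquare {m A B C F} (p≢2 : ¬ p ≡ 2) (degA : DegreeAtMost m A)
    (root : Quadratic A B C F ≈ zeroPS) (B≈0 : B ≈ zeroPS) (C₀≋1 : C 0 ≋ 1ℤ)
    (k : ℕ) (a : ℤ) (a≉0 : ¬ a ≋ 0ℤ) (A≈ : ∀ n → n ≤ k ℕ.+ k → A n ≋ - (mono a k ⊛ mono a k) n) where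

    private
      a² = a * a
      a²≉0 = x≉0∧y≉0⇒x*y≉0 a≉0 a≉0

      square≈ : ∀ n → (mono a k ⊛ mono a k) n ≋ shift (k ℕ.+ k) (const a ⊛ const a) n
      square≈ n = shift-⊛-shift k k (const a) (const a) ! n

    A<2k≋0 : VanishesBelow (k ℕ.+ k) A
    A<2k≋0 i i<2k = ≋-trans (A≈ i (ℕₚ.<⇒≤ i<2k))
      (≋-trans (-‿cong (square≈ i)) (≡⇒≋ (cong -_ (shift-< (k ℕ.+ k) (const a ⊛ const a) i i<2k))))

    A₂ₖ≋-a² : A (k ℕ.+ k) ≋ - a²
    A₂ₖ≋-a² = ≋-trans (A≈ (k ℕ.+ k) ℕₚ.≤-refl) (≋-trans (-‿cong (square≈ (k ℕ.+ k)))
      (≡⇒≋ (cong -_ (trans (shift-at (k ℕ.+ k) (const a ⊛ const a)) (⊛-at-0 (const a) (const a))))))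

    A₂ₖ≉0 : ¬ A (k ℕ.+ k) ≋ 0ℤ
    A₂ₖ≉0 A₂ₖ≋0 = a²≉0 (-≋0⇒≋0 (≋-trans (≋-sym A₂ₖ≋-a²) A₂ₖ≋0))

    2k≤m : k ℕ.+ k ≤ m
    2k≤m with k ℕ.+ k ≤? m
    ... | yes 2k≤m = 2k≤m
    ... | no  2k≰m = ⊥-elim (A₂ₖ≉0 (degA (k ℕ.+ k) (ℕₚ.≰⇒> 2k≰m)))

    CFF≈-A : (C ⊛ F) ⊛ F ≈ ⊖ A
    CFF≈-A = begin
      (C ⊠ F) ⊠ F                         ≈⟨ solve 4 (λ A B C F →
                                                  (C :* F) :* F := ((A :+ B :* F) :+ (C :* F) :* F :- A) :- B :* F)
                                               ≈-refl A B C F ⟩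
      Quadratic A B C F ⊟ A ⊟ B ⊠ F       ≈⟨ ⊝-cong (⊝-cong root (≈-refl {A})) (⊛-cong B≈0 (≈-refl {F})) ⟩
      zeroPS ⊟ A ⊟ zeroPS ⊠ F             ≈⟨ ≡⇒≈ (λ n → trans (cong₂ _+_ (ℤₚ.+-identityˡ (- A n))
                                                   (cong -_ (trans (⊛-comm zeroPS F n) (⊛-zeroʳ F n))))
                                                   (ℤₚ.+-identityʳ (- A n))) ⟩
      ⊖ A                                 ∎
      where open ≈-Reasoning

    square-at-order : ∀ j → VanishesBelow j F → F j * F j ≋ - A (j ℕ.+ j)
    square-at-order j F<j≋0 = ≋-trans (≡⇒≋ (sym (cong (_* F j) (ℤₚ.*-identityˡ (F j)))))
      (≋-trans (*-cong (*-cong (≋-sym C₀≋1) (≋-refl {F j})) (≋-refl {F j}))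
      (≋-trans (≋-sym (⊛-square-at-order j C F F<j≋0)) (CFF≈-A ! (j ℕ.+ j))))

    coefficient-below-order≋0 : ∀ n → n < k → VanishesBelow n F → F n ≋ 0ℤ
    coefficient-below-order≋0 n n<k F<n≋0 = x*x≋0⇒x≋0 {F n}
      (≋-trans (square-at-order n F<n≋0) (≋0⇒-≋0 (A<2k≋0 (n ℕ.+ n) (ℕₚ.+-mono-< n<k n<k))))

    F<k≋0 : VanishesBelow k F
    F<k≋0 = vanishes k ℕₚ.≤-refl
      where
      vanishes : ∀ n → n ≤ k → VanishesBelow n F
      vanishes zero    _     = λ _ ()
      vanishes (suc n) 1+n≤k = vanishesBelow-suc F<n≋0 (coefficient-below-order≋0 n 1+n≤k F<n≋0)
        where F<n≋0 = vanishes n (ℕₚ.<⇒≤ 1+n≤k)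

    Fₖ≉0 : ¬ F k ≋ 0ℤ
    Fₖ≉0 Fₖ≋0 = A₂ₖ≉0 (-≋0⇒≋0 (≋-trans (≋-sym (square-at-order k F<k≋0)) (*-cong Fₖ≋0 (≋-refl {F k}))))

    2A+FB≉0 : ¬ (+ 2 * A (k ℕ.+ k) + F k * B k ≋ 0ℤ)
    2A+FB≉0 e = x≉0∧y≉0⇒x*y≉0 {+ 2} {a²} (2≉0 p≢2) a²≉0 (-≋0⇒≋0 {+ 2 * a²} (begin
      - (+ 2 * a²)                    ≡⟨ lemma a² (F k) ⟨
      + 2 * - a² + F k * 0ℤ           ≈⟨ +-cong (*-cong (≋-refl {+ 2}) (≋-sym A₂ₖ≋-a²))
                                                (*-cong (≋-refl {F k}) (≋-sym (B≈0 ! k))) ⟩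
      + 2 * A (k ℕ.+ k) + F k * B k   ≈⟨ e ⟩
      0ℤ                              ∎))
      where
      open ≋-Reasoning
      lemma : ∀ x f → + 2 * - x + f * 0ℤ ≡ - (+ 2 * x)
      lemma = solve-∀

  polynomial-degree : ∀ {d m f} → (∀ n → d ≤ n → f n ≡[ p ] 0ℤ) → d ≤ m → DegreeAtMost m f
  polynomial-degree f≥d≡0 d≤m n m<n = ≡[]⇒≋ (f≥d≡0 n (ℕₚ.≤-trans d≤m (ℕₚ.<⇒≤ m<n)))

  ≡1⇒≉0 : ∀ {a} → a ≡[ p ] 1ℤ → ¬ a ≋ 0ℤ
  ≡1⇒≉0 {a} a≡1 a≋0 = 1≉0 (≋-trans (≋-sym (≡[]⇒≋ {a} {1ℤ} a≡1)) a≋0)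

  ≡0⇒*≋0 : ∀ {a} b → a ≡[ p ] 0ℤ → a * b ≋ 0ℤ
  ≡0⇒*≋0 {a} b a≡0 = *-cong (≡[]⇒≋ {a} {0ℤ} a≡0) (≋-refl {b})

  -- Case (iii): when F(0) ≠ 0 the first level has order 0.
  constant-term-expansion : ∀ {m A B C F} → DegreeAtMost m A → DegreeAtMost m B → DegreeAtMost (suc m) C →
    Quadratic A B C F ≈ zeroPS → ¬ B 0 ≋ 0ℤ → A 0 ≋ 0ℤ → Dec (F 0 ≋ 0ℤ) → HasUltPeriodicSuper1Fraction p F
  constant-term-expansion {m} {A} {B} {C} {F} degA degB degC root B₀≉0 A₀≋0 (yes F₀≋0) =
    root-expansion {m} {A} {B} {C} {F} degA degB degC root B₀≉0
      (≋-trans (*-cong (≋-refl {C 0}) F₀≋0) (≡⇒≋ (ℤₚ.*-zeroʳ (C 0))))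
  constant-term-expansion {m} {A} {B} {C} {F} degA degB degC root B₀≉0 A₀≋0 (no F₀≉0) =
    level-expansion (reduced-level {m} {A} {B} {C} {F} 0 0 z≤n degA degB degC root
      (λ _ ()) F₀≉0 (λ _ ()) (λ _ ()) 2A₀+F₀B₀≉0)
    where
    2A₀+F₀B₀≉0 : ¬ (+ 2 * A 0 + F 0 * B 0 ≋ 0ℤ)
    2A₀+F₀B₀≉0 e = x≉0∧y≉0⇒x*y≉0 {F 0} {B 0} F₀≉0 B₀≉0 (begin
      F 0 * B 0                ≡⟨ ℤₚ.+-identityˡ (F 0 * B 0) ⟨
      + 2 * 0ℤ + F 0 * B 0     ≈⟨ +-cong (*-cong (≋-refl {+ 2}) A₀≋0) (≋-refl {F 0 * B 0}) ⟨
      + 2 * A 0 + F 0 * B 0    ≈⟨ e ⟩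
      0ℤ                       ∎)
      where open ≋-Reasoning

  expansion-under-conditions : ∀ {m A B C F} → DegreeAtMost m A → DegreeAtMost m B → DegreeAtMost (suc m) C →
    Quadratic A B C F ≈ zeroPS → Conditions p A B C → HasUltPeriodicSuper1Fraction p F
  expansion-under-conditions {m} {A} {B} {C} {F} degA degB degC root (inj₁ (B₀≡1 , C₀≡0 , _)) =
    root-expansion {m} {A} {B} {C} {F} degA degB degC root (≡1⇒≉0 {B 0} B₀≡1) (≡0⇒*≋0 {C 0} (F 0) C₀≡0)
  expansion-under-conditions {m} {A} {B} {C} {F} degA degB degC root (inj₂ (inj₁ (B₀≡1 , C≡0))) =
    root-expansion {m} {A} {B} {C} {F} degA degB degC root (≡1⇒≉0 {B 0} B₀≡1) (≡0⇒*≋0 {C 0} (F 0) (C≡0 0))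
  expansion-under-conditions {m} {A} {B} {C} {F} degA degB degC root (inj₂ (inj₂ (inj₁ (B₀≡1 , _ , A₀≡0)))) =
    constant-term-expansion {m} {A} {B} {C} {F} degA degB degC root (≡1⇒≉0 {B 0} B₀≡1) (≡[]⇒≋ {A 0} {0ℤ} A₀≡0)
      (F 0 ≋? 0ℤ)
  expansion-under-conditions {m} {A} {B} {C} {F} degA degB degC root
    (inj₂ (inj₂ (inj₂ (p≢2 , B≡0 , C₀≡1 , k , a , a≢0 , A≡)))) =
    level-expansion (reduced-level {m} {A} {B} {C} {F} k k (ℕₚ.≤-trans (ℕₚ.m≤m+n k k) 2k≤m) degA degB degC root
      F<k≋0 Fₖ≉0 A<2k≋0 (λ i _ → B≈0 ! i) 2A+FB≉0)
    where
    B≈0 = ≈[]⇒≈ {B} {zeroPS} B≡0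
    A≈ : ∀ n → n ≤ k ℕ.+ k → A n ≋ - (mono a k ⊛ mono a k) n
    A≈ n n≤2k = ≡[]⇒≋ (A≡ n (subst (n ≤_) (cong (k ℕ.+_) (sym (ℕₚ.+-identityʳ k))) n≤2k))
    open PureSquare {m} {A} {B} {C} {F} p≢2 degA root B≈0 (≡[]⇒≋ {C 0} {1ℤ} C₀≡1) k a (a≢0 ∘ ≋⇒≡[] {a} {0ℤ}) A≈

theorem3p5 : (p : ℕ) → Prime p → (A B C F : PS) →
    IsPoly p A → IsPoly p B → IsPoly p C →
    Conditions p A B C →
    ((A ⊕ (B ⊛ F)) ⊕ ((C ⊛ F) ⊛ F)) ≈[ p ] zeroPS →
    HasUltPeriodicSuper1Fraction p F
theorem3p5 p p-prime A B C F (dA , A≥dA≡0) (dB , B≥dB≡0) (dC , C≥dC≡0) conditions root =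
  expansion-under-conditions {m} {A} {B} {C} {F}
    (polynomial-degree A≥dA≡0 (ℕₚ.≤-trans (ℕₚ.m≤m⊔n dA dB) (ℕₚ.m≤m⊔n (dA ⊔ dB) dC)))
    (polynomial-degree B≥dB≡0 (ℕₚ.≤-trans (ℕₚ.m≤n⊔m dA dB) (ℕₚ.m≤m⊔n (dA ⊔ dB) dC)))
    (polynomial-degree C≥dC≡0 (ℕₚ.≤-trans (ℕₚ.m≤n⊔m (dA ⊔ dB) dC) (ℕₚ.n≤1+n m)))
    (≈[]⇒≈ root) conditions
  where
  open PowerSeriesOverField p p-prime
  m = dA ⊔ dB ⊔ dC
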